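{- Let $p,q,r$ be fixed positive integers with $p\geq q\geq r$ and $\gcd(p,q,r)=1$, and let $\mathcal{L}$ denote $px+qy=rz$. Let $t:=\gcd(p,q)$, $r_1:=p/t$, $r_2:=q/t$. Let $S$ be an $\mathcal{L}$-free subset of $[n]$. If $M\in S$ is divisible by $t$, then $S$ contains at most $$\Big\lceil\frac{rM}{q}\Big\rceil-1-\Big\lfloor\frac{rM}{r_2(p+q)}\Big\rfloor-(r_1r_2-r_1-r_2+1)\Big\lfloor\Big\lfloor\frac{rM}{r_1(p+q)}-\frac{1}{r_2}\Big\rfloor\frac{1}{r_1r_2}\Big\rfloor$$ elements from $[\lceil rM/q\rceil-1]$.
   Context: $[m]=\{1,\dots,m\}$. A set $A\subseteq[n]$ is $\mathcal{L}$-free if there are no $x,y,z\in A$ (not necessarily distinct) with $px+qy=rz$. -}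

module Defs where

open import Data.Bool using (Bool; true; T)
open import Data.Nat using (ℕ; zero; suc; _+_; _*_; _≤_)
open import Data.Integer using (ℤ; +_)
open import Data.Rational using (ℚ; _/_)
open import Data.List using (List; length; filter; applyUpTo)
open import Relation.Nullary using (¬_)
open import Relation.Binary.PropositionalEquality using (_≡_)
open import Data.Bool.Properties using (T?)

_∈ₛ_ : ℕ → (ℕ → Bool) → Set
x ∈ₛ S = T (S x)

SubsetOf[_] : ℕ → (ℕ → Bool) → Set
SubsetOf[ n ] S = ∀ x → x ∈ₛ S → 1 ≤ x × x ≤ n
  where open import Data.Product using (_×_)

-- S is L-free for L : p x + q y = r z  (x, y, z not necessarily distinct)
LFree : ℕ → ℕ → ℕ → (ℕ → Bool) → Set
LFree p q r S = ∀ x y z → x ∈ₛ S → y ∈ₛ S → z ∈ₛ S → ¬ (p * x + q * y ≡ r * z)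

[1‥_] : ℕ → List ℕ
[1‥ K ] = applyUpTo suc K

countIn : (ℕ → Bool) → ℕ → ℕ
countIn S K = length (filter (λ x → T? (S x)) [1‥ K ])

-- the rational number a / d; only ever used with d > 0
-- (the value at d = 0 is an irrelevant default)
_÷_ : ℤ → ℕ → ℚ
a ÷ zero    = + 0 / 1
a ÷ (suc d) = a / suc d

-- Write p = r₁ t, q = r₂ t, M = k t and m = r k. Then p x + q y = r M reads r₁ x + r₂ y = m,
-- and since M ∈ S no solution (x, y) of it has both coordinates in S. Every positive solution
-- lies in [K], K = ⌈rM/q⌉ − 1, so if the solutions are viewed as edges of a graph on [K], a
-- matching of N edges leaves at least N elements of [K] outside S. Such a matching is built
-- from two kinds of solutions. On the side x ≤ y the solutions x = ρ, ρ + r₂, ρ + 2r₂, …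
-- are pairwise disjoint; there are ⌊rM/(r₂(p+q))⌋ of them. On the side y < x the solutions
-- y = σ + r₁ν are grouped into ⌊⌊rM/(r₁(p+q)) − 1/r₂⌋/(r₁r₂)⌋ blocks of r₁r₂ consecutive ν.
-- Within a block, a solution sharing a vertex with another solution is pinned down by
-- congruences modulo r₂ (one per row) and modulo r₁ (one row), so at least (r₁ − 1)(r₂ − 1)
-- edges of each block are isolated.

module Submission where

open import Data.Nat using (ℕ; NonZero)
open import Data.Nat.Coprimality using (Coprime)
open import Relation.Binary.PropositionalEquality using (_≡_; trans)

infixr 5 _∙_
_∙_ : ∀ {A : Set} {x y z : A} → x ≡ y → y ≡ z → x ≡ z
_∙_ = trans

module Counting where

  open import Defs using (countIn)
  open import Data.Nat
  open import Data.Nat.Properties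
  open import Algebra.Properties.CommutativeSemigroup +-commutativeSemigroup using (interchange; xy∙z≈xz∙y)
  open import Data.Bool using (Bool; true; false; T; not; _∧_)
  open import Data.Bool.Properties using (T?; ∧-zeroʳ; ∧-identityʳ)
  open import Data.List using (List; []; _∷_; length; filter; applyUpTo; _∷ʳ_)
  open import Data.List.Properties using (applyUpTo-∷ʳ; filter-++; length-++)
  open import Data.Product using (_×_; _,_; proj₁; proj₂; ∃)
  open import Data.Sum using (inj₁; inj₂)
  open import Data.Empty using (⊥-elim)
  open import Data.Unit using (tt)
  open import Function using (_∘_)
  open import Relation.Nullary using (¬_; Dec; yes; no; does)
  open import Relation.Nullary.Decidable using (dec-true; dec-false)
  open import Relation.Binary.PropositionalEquality

  fromBool : Bool → ℕ
  fromBool true  = 1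
  fromBool false = 0

  count : (ℕ → Bool) → ℕ → ℕ
  count G zero    = 0
  count G (suc n) = count G n + fromBool (G n)

  length-filter-∷ʳ : (P : ℕ → Bool) (xs : List ℕ) (x : ℕ) →
    length (filter (T? ∘ P) (xs ∷ʳ x)) ≡ length (filter (T? ∘ P) xs) + fromBool (P x)
  length-filter-∷ʳ P xs x
    rewrite filter-++ (T? ∘ P) xs (x ∷ []) | length-++ (filter (T? ∘ P) xs) {filter (T? ∘ P) (x ∷ [])}
    with P x
  ... | true  = refl
  ... | false = refl

  countIn≡count : ∀ S K → countIn S K ≡ count (S ∘ suc) K
  countIn≡count S zero    = refl
  countIn≡count S (suc K) =
    cong (length ∘ filter (T? ∘ S)) (sym (applyUpTo-∷ʳ suc K))
    ∙ length-filter-∷ʳ S (applyUpTo suc K) (suc K)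
    ∙ cong (_+ fromBool (S (suc K))) (countIn≡count S K)

  count-complement : ∀ G n → count G n + count (not ∘ G) n ≡ n
  count-complement G zero    = refl
  count-complement G (suc n) = begin
    count G n + fromBool (G n) + (count (not ∘ G) n + fromBool (not (G n)))
      ≡⟨ interchange (count G n) _ _ _ ⟩
    count G n + count (not ∘ G) n + (fromBool (G n) + fromBool (not (G n)))
      ≡⟨ cong₂ _+_ (count-complement G n) (lemma (G n)) ⟩
    n + 1
      ≡⟨ +-comm n 1 ⟩
    suc n ∎
    where
    open ≡-Reasoning
    lemma : ∀ b → fromBool b + fromBool (not b) ≡ 1
    lemma true  = refl
    lemma false = refl

  count-mono : ∀ G {m n} → m ≤ n → count G m ≤ count G n
  count-mono G {n = zero}  z≤n  = ≤-refl
  count-mono G {n = suc n} m≤1+n with m≤n⇒m<n∨m≡n m≤1+n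
  ... | inj₂ refl      = ≤-refl
  ... | inj₁ (s≤s m≤n) = ≤-trans (count-mono G m≤n) (m≤m+n (count G n) _)

  count-suc : ∀ G i → T (G i) → count G (suc i) ≡ suc (count G i)
  count-suc G i Gi with G i
  ... | true = +-comm (count G i) 1

  count-+ : ∀ G m n → count G (m + n) ≡ count G m + count (λ i → G (m + i)) n
  count-+ G m zero    = cong (count G) (+-identityʳ m) ∙ sym (+-identityʳ _)
  count-+ G m (suc n) =
    cong (count G) (+-suc m n) ∙ cong (_+ fromBool (G (m + n))) (count-+ G m n) ∙ +-assoc (count G m) _ _

  count-cong : ∀ {G H} n → (∀ i → i < n → G i ≡ H i) → count G n ≡ count H n
  count-cong zero    G≗H = refl
  count-cong (suc n) G≗H =
    cong₂ _+_ (count-cong n (λ i i<n → G≗H i (m<n⇒m<1+n i<n))) (cong fromBool (G≗H n ≤-refl))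

  count-all : ∀ G n → (∀ i → i < n → T (G i)) → count G n ≡ n
  count-all G zero    _  = refl
  count-all G (suc n) all with G n | all n ≤-refl
  ... | true | _ = cong (_+ 1) (count-all G n (λ i i<n → all i (m<n⇒m<1+n i<n))) ∙ +-comm n 1

  count-none : ∀ G n → (∀ i → i < n → ¬ T (G i)) → count G n ≡ 0
  count-none G zero    _    = refl
  count-none G (suc n) none with G n in eq
  ... | true  = ⊥-elim (none n ≤-refl (subst T (sym eq) tt))
  ... | false = +-identityʳ _ ∙ count-none G n (λ i i<n → none i (m<n⇒m<1+n i<n))

  count≡0⇒none : ∀ G n → count G n ≡ 0 → ∀ {i} → i < n → ¬ T (G i)
  count≡0⇒none G n none {i} i<n Gi = 1+n≰n (begin
    1                   ≤⟨ s≤s z≤n ⟩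
    suc (count G i)     ≡⟨ count-suc G i Gi ⟨
    count G (suc i)     ≤⟨ count-mono G i<n ⟩
    count G n           ≡⟨ none ⟩
    0                   ∎)
    where open ≤-Reasoning

  count≢0⇒some : ∀ G n → count G n ≢ 0 → ∃ λ i → i < n × T (G i)
  count≢0⇒some G zero    some = ⊥-elim (some refl)
  count≢0⇒some G (suc n) some with G n in eq
  ... | true  = n , ≤-refl , subst T (sym eq) tt
  ... | false with count≢0⇒some G n (λ none → some (+-identityʳ _ ∙ none))
  ...   | i , i<n , Gi = i , m<n⇒m<1+n i<n , Gi

  _without_ : (ℕ → Bool) → ℕ → ℕ → Bool
  (Q without v) x = Q x ∧ not (does (x ≟ v))

  fromBool-∧-≤ : ∀ a b → fromBool (a ∧ b) ≤ fromBool a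
  fromBool-∧-≤ true  true  = ≤-refl
  fromBool-∧-≤ true  false = z≤n
  fromBool-∧-≤ false _     = z≤n

  T-without : ∀ Q {v x} → T (Q x) → x ≢ v → T ((Q without v) x)
  T-without Q {v} {x} Qx x≢v rewrite dec-false (x ≟ v) x≢v | ∧-identityʳ (Q x) = Qx

  count-without-below : ∀ Q {v} K → K ≤ v → count (Q without v) K ≡ count Q K
  count-without-below Q zero    _     = refl
  count-without-below Q {v} (suc K) 1+K≤v
    rewrite dec-false (K ≟ v) (<⇒≢ 1+K≤v) | ∧-identityʳ (Q K) =
    cong (_+ fromBool (Q K)) (count-without-below Q K (≤-trans (n≤1+n K) 1+K≤v))

  count-without : ∀ Q {v} K → v < K → T (Q v) → suc (count (Q without v) K) ≤ count Q K
  count-without Q {v} (suc K) v<1+K Qv with m≤n⇒m<n∨m≡n (s≤s⁻¹ v<1+K)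
  ... | inj₁ v<K  = +-mono-≤ (count-without Q K v<K Qv) (fromBool-∧-≤ (Q K) _)
  ... | inj₂ refl = begin
    suc (count (Q without v) v + fromBool ((Q without v) v))
      ≡⟨ cong (λ b → suc (count (Q without v) v + fromBool (Q v ∧ not b))) (dec-true (v ≟ v) refl) ⟩
    suc (count (Q without v) v + fromBool (Q v ∧ false))
      ≡⟨ cong (λ b → suc (count (Q without v) v + fromBool b)) (∧-zeroʳ (Q v)) ⟩
    suc (count (Q without v) v + 0)
      ≡⟨ cong suc (+-identityʳ _ ∙ count-without-below Q v ≤-refl) ⟩
    suc (count Q v)
      ≡⟨ count-suc Q v Qv ⟨
    count Q (suc v) ∎
    where
    open ≤-Reasoning

  count-injection : ∀ (G Q : ℕ → Bool) N K (g : ℕ → ℕ) →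
    (∀ i → i < N → T (G i) → g i < K × T (Q (g i))) →
    (∀ {i j} → i < N → j < N → T (G i) → T (G j) → g i ≡ g j → i ≡ j) →
    count G N ≤ count Q K
  count-injection G Q zero    K g into inj = z≤n
  count-injection G Q (suc N) K g into inj with G N in eq
  ... | false = ≤-trans (≤-reflexive (+-identityʳ _))
                  (count-injection G Q N K g (λ i i<N → into i (m<n⇒m<1+n i<N))
                     (λ i<N j<N → inj (m<n⇒m<1+n i<N) (m<n⇒m<1+n j<N)))
  ... | true  = begin
    count G N + 1                    ≡⟨ +-comm (count G N) 1 ⟩
    suc (count G N)                  ≤⟨ s≤s rest ⟩
    suc (count (Q without g N) K)    ≤⟨ count-without Q K (proj₁ gN) (proj₂ gN) ⟩
    count Q K                        ∎
    where
    open ≤-Reasoning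
    GN : T (G N)
    GN rewrite eq = tt
    gN = into N ≤-refl GN
    rest : count G N ≤ count (Q without g N) K
    rest = count-injection G (Q without g N) N K g
      (λ i i<N Gi → proj₁ (into i (m<n⇒m<1+n i<N) Gi) ,
         T-without Q (proj₂ (into i (m<n⇒m<1+n i<N) Gi))
           (λ gi≡gN → <⇒≢ i<N (inj (m<n⇒m<1+n i<N) ≤-refl Gi GN gi≡gN)))
      (λ i<N j<N → inj (m<n⇒m<1+n i<N) (m<n⇒m<1+n j<N))

  AtMostOne : (ℕ → Set) → ℕ → Set
  AtMostOne P n = ∀ {i j} → i < n → j < n → P i → P j → i ≡ j

  atMostOne-suc⁻ : ∀ {P n} → AtMostOne P (suc n) → AtMostOne P n
  atMostOne-suc⁻ amo i<n j<n = amo (m<n⇒m<1+n i<n) (m<n⇒m<1+n j<n)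

  count-atMostOne : ∀ B n → AtMostOne (T ∘ B) n → count B n ≤ 1
  count-atMostOne B zero    amo = z≤n
  count-atMostOne B (suc n) amo with B n in eq
  ... | false = ≤-trans (≤-reflexive (+-identityʳ _)) (count-atMostOne B n (atMostOne-suc⁻ amo))
  ... | true  = ≤-reflexive (cong (_+ 1) (count-none B n (λ i i<n Bi →
                  <⇒≢ i<n (amo (m<n⇒m<1+n i<n) ≤-refl Bi (subst T (sym eq) tt)))))

  count-not-atMostOne : ∀ B n → AtMostOne (T ∘ B) n → n ≤ count (not ∘ B) n + 1
  count-not-atMostOne B n amo = begin
    n                               ≡⟨ count-complement B n ⟨
    count B n + count (not ∘ B) n   ≤⟨ +-monoˡ-≤ _ (count-atMostOne B n amo) ⟩
    1 + count (not ∘ B) n           ≡⟨ +-comm 1 _ ⟩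
    count (not ∘ B) n + 1           ∎
    where open ≤-Reasoning

  row : (ℕ → Bool) → ℕ → ℕ → ℕ → Bool
  row H d w u = H (w * d + u)

  count-suc-rows : ∀ H L d → count H (suc L * d) ≡ count H (L * d) + count (row H d L) d
  count-suc-rows H L d = cong (count H) (+-comm d (L * d)) ∙ count-+ H (L * d) d

  count-rows : ∀ H L d c → (∀ w → w < L → c ≤ count (row H d w) d) → L * c ≤ count H (L * d)
  count-rows H zero    d c full = z≤n
  count-rows H (suc L) d c full = begin
    c + L * c                                      ≡⟨ +-comm c (L * c) ⟩
    L * c + c                                      ≤⟨ +-mono-≤ rest (full L ≤-refl) ⟩
    count H (L * d) + count (row H d L) d          ≡⟨ count-suc-rows H L d ⟨
    count H (suc L * d)                            ∎
    where
    open ≤-Reasoning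
    rest : L * c ≤ count H (L * d)
    rest = count-rows H L d c (λ w w<L → full w (m<n⇒m<1+n w<L))

  count-rows-but-one : ∀ H L d c (P : ℕ → Set) → (∀ w → Dec (P w)) →
    (∀ w → w < L → P w → c ≤ count (row H d w) d) → AtMostOne (¬_ ∘ P) L →
    L * c ≤ count H (L * d) + c
  count-rows-but-one H zero    d c P P? full amo = z≤n
  count-rows-but-one H (suc L) d c P P? full amo with P? L
  ... | yes PL = begin
    c + L * c                                      ≡⟨ +-comm c (L * c) ⟩
    L * c + c                                      ≤⟨ +-monoˡ-≤ c (count-rows-but-one H L d c P P? full' (atMostOne-suc⁻ amo)) ⟩
    count H (L * d) + c + c                        ≤⟨ +-monoʳ-≤ _ (full L ≤-refl PL) ⟩
    count H (L * d) + c + count (row H d L) d      ≡⟨ xy∙z≈xz∙y (count H (L * d)) c _ ⟩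
    count H (L * d) + count (row H d L) d + c      ≡⟨ cong (_+ c) (count-suc-rows H L d) ⟨
    count H (suc L * d) + c                        ∎
    where
    open ≤-Reasoning
    full' : ∀ w → w < L → P w → c ≤ count (row H d w) d
    full' w w<L = full w (m<n⇒m<1+n w<L)
  ... | no ¬PL = begin
    c + L * c                  ≡⟨ +-comm c (L * c) ⟩
    L * c + c                  ≤⟨ +-monoˡ-≤ c (count-rows H L d c (λ w w<L → full w (m<n⇒m<1+n w<L) (P-below w w<L))) ⟩
    count H (L * d) + c        ≤⟨ +-monoˡ-≤ c (count-mono H (m≤n+m (L * d) d)) ⟩
    count H (suc L * d) + c    ∎
    where
    open ≤-Reasoning
    P-below : ∀ w → w < L → P w
    P-below w w<L with P? w
    ... | yes Pw  = Pw
    ... | no ¬Pw = ⊥-elim (<⇒≢ w<L (amo (m<n⇒m<1+n w<L) ≤-refl ¬Pw ¬PL))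

module Matching where

  open Counting
  open import Defs using (countIn)
  open import Data.Nat
  open import Data.Nat.Properties
  open import Data.Bool using (Bool; true; false; T; not; if_then_else_)
  open import Data.Product using (_×_; _,_; proj₁; proj₂)
  open import Data.Sum using (_⊎_; inj₁; inj₂)
  open import Data.Empty using (⊥; ⊥-elim)
  open import Data.Unit using (tt)
  open import Function using (_∘_)
  open import Relation.Nullary using (¬_; yes; no)
  open import Relation.Binary.PropositionalEquality

  _++[_]_ : {A : Set} → (ℕ → A) → ℕ → (ℕ → A) → ℕ → A
  (f ++[ k ] g) i = if i <ᵇ k then f i else g (i ∸ k)

  data Side (k i : ℕ) : Set where
    left  : i < k → Side k i
    right : ∀ j → k + j ≡ i → Side k i

  side : ∀ k i → Side k i
  side k i with i <? k
  ... | yes i<k = left i<k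
  ... | no  i≮k = right (i ∸ k) (m+[n∸m]≡n (≮⇒≥ i≮k))

  ++-left : ∀ {A : Set} (f g : ℕ → A) {k i} → i < k → (f ++[ k ] g) i ≡ f i
  ++-left f g {k} {i} i<k with i <ᵇ k | <⇒<ᵇ i<k
  ... | true | _ = refl

  ++-right : ∀ {A : Set} (f g : ℕ → A) k j → (f ++[ k ] g) (k + j) ≡ g j
  ++-right f g k j with (k + j) <ᵇ k in eq
  ... | true  = ⊥-elim (<-irrefl refl (<-≤-trans (<ᵇ⇒< (k + j) k (subst T (sym eq) tt)) (m≤m+n k j)))
  ... | false = cong g (m+n∸m≡n k j)

  count-++ : ∀ F G k n → count (F ++[ k ] G) (k + n) ≡ count F k + count G n
  count-++ F G k n =
    count-+ (F ++[ k ] G) k n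
    ∙ cong₂ _+_ (count-cong k (λ i i<k → ++-left F G i<k)) (count-cong n (λ j _ → ++-right F G k j))

  all-++ : ∀ {A : Set} (P : A → Set) (f g : ℕ → A) k n →
    (∀ i → i < k → P (f i)) → (∀ j → j < n → P (g j)) → ∀ i → i < k + n → P ((f ++[ k ] g) i)
  all-++ P f g k n Pf Pg i i<k+n with side k i
  ... | left i<k        = subst P (sym (++-left f g i<k)) (Pf i i<k)
  ... | right j refl    = subst P (sym (++-right f g k j)) (Pg j (+-cancelˡ-< k j n i<k+n))

  Edge : Set
  Edge = ℕ × ℕ

  Endpoint : Edge → ℕ → Set
  Endpoint (x , y) v = v ≡ x ⊎ v ≡ y

  IsMatching : (ℕ → Edge) → (ℕ → Bool) → ℕ → Set
  IsMatching E G N = ∀ {i j v} → i < N → j < N → T (G i) → T (G j) →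
    Endpoint (E i) v → Endpoint (E j) v → i ≡ j

  matching-++ : ∀ E₁ G₁ k E₂ G₂ n → IsMatching E₁ G₁ k → IsMatching E₂ G₂ n →
    (∀ {i j v} → i < k → j < n → T (G₁ i) → T (G₂ j) → Endpoint (E₁ i) v → Endpoint (E₂ j) v → ⊥) →
    IsMatching (E₁ ++[ k ] E₂) (G₁ ++[ k ] G₂) (k + n)
  matching-++ E₁ G₁ k E₂ G₂ n M₁ M₂ apart {i} {j} i<k+n j<k+n Gi Gj vi vj with side k i | side k j
  ... | left i<k | left j<k = M₁ i<k j<k
    (subst T (++-left G₁ G₂ i<k) Gi) (subst T (++-left G₁ G₂ j<k) Gj)
    (subst (λ e → Endpoint e _) (++-left E₁ E₂ i<k) vi) (subst (λ e → Endpoint e _) (++-left E₁ E₂ j<k) vj)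
  ... | left i<k | right j' refl = ⊥-elim (apart i<k (+-cancelˡ-< k j' n j<k+n)
    (subst T (++-left G₁ G₂ i<k) Gi) (subst T (++-right G₁ G₂ k j') Gj)
    (subst (λ e → Endpoint e _) (++-left E₁ E₂ i<k) vi) (subst (λ e → Endpoint e _) (++-right E₁ E₂ k j') vj))
  ... | right i' refl | left j<k = ⊥-elim (apart j<k (+-cancelˡ-< k i' n i<k+n)
    (subst T (++-left G₁ G₂ j<k) Gj) (subst T (++-right G₁ G₂ k i') Gi)
    (subst (λ e → Endpoint e _) (++-left E₁ E₂ j<k) vj) (subst (λ e → Endpoint e _) (++-right E₁ E₂ k i') vi))
  ... | right i' refl | right j' refl = cong (k +_) (M₂ (+-cancelˡ-< k i' n i<k+n) (+-cancelˡ-< k j' n j<k+n)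
    (subst T (++-right G₁ G₂ k i') Gi) (subst T (++-right G₁ G₂ k j') Gj)
    (subst (λ e → Endpoint e _) (++-right E₁ E₂ k i') vi) (subst (λ e → Endpoint e _) (++-right E₁ E₂ k j') vj))

  avoid : (ℕ → Bool) → Edge → ℕ
  avoid S (x , y) = if S x then y else x

  avoid-endpoint : ∀ (S : ℕ → Bool) e → Endpoint e (avoid S e)
  avoid-endpoint S (x , y) with S x
  ... | true  = inj₂ refl
  ... | false = inj₁ refl

  avoid-∉ : ∀ (S : ℕ → Bool) x y → (T (S x) → ¬ T (S y)) → ¬ T (S (avoid S (x , y)))
  avoid-∉ S x y notBoth with S x in eq
  ... | true  = notBoth tt
  ... | false = λ Sx → subst T eq Sx

  -- Picking an endpoint outside S in every selected edge injects the matching into [1, K] ∖ S.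
  matching-count : ∀ (S : ℕ → Bool) K E G N → IsMatching E G N →
    (∀ {i v} → i < N → T (G i) → Endpoint (E i) v → 1 ≤ v × v ≤ K) →
    (∀ i → i < N → T (G i) → T (S (proj₁ (E i))) → ¬ T (S (proj₂ (E i)))) →
    count G N + countIn S K ≤ K
  matching-count S K E G N M range notBoth = begin
    count G N + countIn S K                 ≤⟨ +-mono-≤ injection (≤-reflexive (countIn≡count S K)) ⟩
    count Q K + count (S ∘ suc) K           ≡⟨ +-comm (count Q K) _ ⟩
    count (S ∘ suc) K + count Q K           ≡⟨ count-complement (S ∘ suc) K ⟩
    K                                       ∎
    where
    open ≤-Reasoning
    Q : ℕ → Bool
    Q v = not (S (suc v))
    g : ℕ → ℕ
    g i = avoid S (E i)
    g-range : ∀ {i} → i < N → T (G i) → 1 ≤ g i × g i ≤ K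
    g-range i<N Gi = range i<N Gi (avoid-endpoint S _)
    g-pos : ∀ {i} → i < N → T (G i) → suc (g i ∸ 1) ≡ g i
    g-pos i<N Gi = m+[n∸m]≡n (proj₁ (g-range i<N Gi))
    g∉S : ∀ i → i < N → T (G i) → T (Q (g i ∸ 1))
    g∉S i i<N Gi with S (suc (g i ∸ 1)) in eq
    ... | false = tt
    ... | true  = avoid-∉ S _ _ (notBoth i i<N Gi) (subst T (cong S (g-pos i<N Gi)) (subst T (sym eq) tt))
    injection : count G N ≤ count Q K
    injection = count-injection G Q N K (λ i → g i ∸ 1)
      (λ i i<N Gi → subst (_≤ K) (sym (g-pos i<N Gi)) (proj₂ (g-range i<N Gi)) , g∉S i i<N Gi)
      (λ i<N j<N Gi Gj eq → M i<N j<N Gi Gj (avoid-endpoint S _)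
         (subst (Endpoint _) (sym (sym (g-pos i<N Gi) ∙ cong suc eq ∙ g-pos j<N Gj)) (avoid-endpoint S _)))

module Residues where

  open import Data.Nat
  open import Data.Nat.Properties
  open import Data.Nat.DivMod
  open import Data.Nat.Divisibility using (_∣_; divides; ∣⇒≤; n∣m*n)
  open import Data.Nat.Coprimality using (Coprime; coprime-Bézout)
  open import Data.Nat.GCD using (module Bézout)
  open import Data.Nat.Tactic.RingSolver using (solve-∀; solve)
  open import Data.List using (_∷_; [])
  open import Data.Product using (_×_; _,_; proj₁; proj₂; ∃)
  open import Data.Sum using (inj₁; inj₂)
  open import Data.Empty using (⊥-elim)
  open import Relation.Binary.PropositionalEquality

  infix 4 _≡_modulo_
  record _≡_modulo_ (x y n : ℕ) : Set where
    constructor congruent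
    field
      k l : ℕ
      x+nk≡y+nl : x + n * k ≡ y + n * l

  ≡-mod-+ : ∀ {x y n} i → x ≡ y modulo n → x + n * i ≡ y modulo n
  ≡-mod-+ {x} {y} {n} i (congruent k l eq) = congruent k (l + i) (begin
    x + n * i + n * k   ≡⟨ solve (x ∷ n ∷ i ∷ k ∷ []) ⟩
    x + n * k + n * i   ≡⟨ cong (_+ n * i) eq ⟩
    y + n * l + n * i   ≡⟨ solve (y ∷ n ∷ l ∷ i ∷ []) ⟩
    y + n * (l + i)     ∎)
    where open ≡-Reasoning

  ≡-mod-+⁻ : ∀ {x y n} i → x + n * i ≡ y modulo n → x ≡ y modulo n
  ≡-mod-+⁻ {x} {y} {n} i (congruent k l eq) = congruent (i + k) l (begin
    x + n * (i + k)     ≡⟨ solve (x ∷ n ∷ i ∷ k ∷ []) ⟩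
    x + n * i + n * k   ≡⟨ eq ⟩
    y + n * l           ∎)
    where open ≡-Reasoning

  *-≡-mod-shift : ∀ {c x y n} i → c * x ≡ y modulo n → c * (x + n * i) ≡ y modulo n
  *-≡-mod-shift {c} {x} {y} {n} i cx≡y = subst (_≡ y modulo n) (distrib c x n i) (≡-mod-+ (c * i) cx≡y)
    where
    distrib : ∀ c x n i → c * x + n * (c * i) ≡ c * (x + n * i)
    distrib = solve-∀

  ≡-mod⇒∣∸ : ∀ {x y n} → x ≡ y modulo n → n ∣ y ∸ x
  ≡-mod⇒∣∸ {x} {y} {n} (congruent k l eq) = divides (k ∸ l) (begin
    y ∸ x                    ≡⟨ cong (_∸ x) (m+n∸n≡m y (n * l)) ⟨
    y + n * l ∸ n * l ∸ x    ≡⟨ cong (λ z → z ∸ n * l ∸ x) eq ⟨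
    x + n * k ∸ n * l ∸ x    ≡⟨ ∸-+-assoc (x + n * k) (n * l) x ∙ cong (x + n * k ∸_) (+-comm (n * l) x) ⟩
    x + n * k ∸ (x + n * l)  ≡⟨ [m+n]∸[m+o]≡n∸o x (n * k) (n * l) ⟩
    n * k ∸ n * l            ≡⟨ *-distribˡ-∸ n k l ⟨
    n * (k ∸ l)              ≡⟨ *-comm n (k ∸ l) ⟩
    (k ∸ l) * n              ∎)
    where open ≡-Reasoning

  linear-congruence-solvable : ∀ {a b} m .{{_ : NonZero b}} → Coprime a b → ∃ λ x → a * x ≡ m modulo b
  linear-congruence-solvable {a} {b} m a⊥b with coprime-Bézout a⊥b
  ... | Bézout.+- x y eq = m * x , congruent 0 (m * y) (begin
    a * (m * x) + b * 0  ≡⟨ solve (a ∷ m ∷ x ∷ b ∷ []) ⟩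
    m * (x * a)          ≡⟨ cong (m *_) eq ⟨
    m * (1 + y * b)      ≡⟨ solve (m ∷ y ∷ b ∷ []) ⟩
    m + b * (m * y)      ∎)
    where open ≡-Reasoning
  linear-congruence-solvable {a} {b@(suc b-1)} m a⊥b | Bézout.-+ x y eq = x * m * b-1 , congruent m (y * m * b-1) (begin
    a * (x * m * b-1) + b * m  ≡⟨ solve (a ∷ x ∷ m ∷ b-1 ∷ []) ⟩
    m + (1 + x * a) * m * b-1  ≡⟨ cong (λ z → m + z * m * b-1) eq ⟩
    m + y * b * m * b-1        ≡⟨ solve (m ∷ y ∷ b-1 ∷ []) ⟩
    m + b * (y * m * b-1)      ∎)
    where open ≡-Reasoning

  positive-representative : ∀ {a b m x} .{{_ : NonZero b}} → a * x ≡ m modulo b →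
    ∃ λ ρ → 1 ≤ ρ × ρ ≤ b × a * ρ ≡ m modulo b
  positive-representative {a} {b} {m} {x} ax≡m = positive (x % b) (m%n<n x b) residue
    where
    split : a * x ≡ a * (x % b) + b * (a * (x / b))
    split = cong (a *_) (m≡m%n+[m/n]*n x b) ∙ distrib a (x % b) (x / b) b
      where
      distrib : ∀ a r q b → a * (r + q * b) ≡ a * r + b * (a * q)
      distrib = solve-∀
    residue : a * (x % b) ≡ m modulo b
    residue = ≡-mod-+⁻ (a * (x / b)) (subst (_≡ m modulo b) split ax≡m)
    positive : ∀ r → r < b → a * r ≡ m modulo b → ∃ λ ρ → 1 ≤ ρ × ρ ≤ b × a * ρ ≡ m modulo b
    positive zero    _   a0≡m = b , >-nonZero⁻¹ b , ≤-refl ,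
      subst (_≡ m modulo b) (cong (_+ b * a) (*-zeroʳ a) ∙ *-comm b a) (≡-mod-+ a a0≡m)
    positive (suc r) r<b ar≡m = suc r , s≤s z≤n , <⇒≤ r<b , ar≡m

  residue-unique-≤ : ∀ c {d u u′ z z′} → (∀ e → d ∣ c * e → d ∣ e) → u ≤ u′ → u′ < d →
    c * u + d * z ≡ c * u′ + d * z′ → u ≡ u′
  residue-unique-≤ c {d} {u} {u′} {z} {z′} cancel u≤u′ u′<d eq with m≤n⇒∃[o]m+o≡n u≤u′
  ... | zero  , refl = sym (+-identityʳ u)
  ... | suc e , refl = ⊥-elim (<-irrefl refl (≤-<-trans (∣⇒≤ (cancel (suc e) d∣ce)) (≤-<-trans (m≤n+m (suc e) u) u′<d)))
    where
    dz≡ce+dz′ : d * z ≡ c * suc e + d * z′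
    dz≡ce+dz′ = +-cancelˡ-≡ (c * u) _ _ (eq ∙ cong (_+ d * z′) (*-distribˡ-+ c u (suc e)) ∙ +-assoc (c * u) _ _)
    d∣ce : d ∣ c * suc e
    d∣ce = divides (z ∸ z′) (begin
      c * suc e                     ≡⟨ m+n∸n≡m (c * suc e) (d * z′) ⟨
      c * suc e + d * z′ ∸ d * z′   ≡⟨ cong (_∸ d * z′) dz≡ce+dz′ ⟨
      d * z ∸ d * z′                ≡⟨ *-distribˡ-∸ d z z′ ⟨
      d * (z ∸ z′)                  ≡⟨ *-comm d (z ∸ z′) ⟩
      (z ∸ z′) * d                  ∎)
      where open ≡-Reasoning

  residue-unique : ∀ c {d u u′ z z′} → (∀ e → d ∣ c * e → d ∣ e) → u < d → u′ < d →
    c * u + d * z ≡ c * u′ + d * z′ → u ≡ u′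
  residue-unique c {u = u} {u′} cancel u<d u′<d eq with ≤-total u u′
  ... | inj₁ u≤u′ = residue-unique-≤ c cancel u≤u′ u′<d eq
  ... | inj₂ u′≤u = sym (residue-unique-≤ c cancel u′≤u u<d (sym eq))

  divMod-unique : ∀ {d} .{{_ : NonZero d}} q r → r < d → (r + q * d) / d ≡ q × (r + q * d) % d ≡ r
  divMod-unique {d} q r r<d =
    +-distrib-/-∣ʳ r (n∣m*n q) ∙ cong₂ _+_ (m<n⇒m/n≡0 r<d) (m*n/n≡m q d) ,
    [m+kn]%n≡m%n r q d ∙ m<n⇒m%n≡m r<d

  divMod-injective : ∀ {d} .{{_ : NonZero d}} {q q′ r r′} → r < d → r′ < d →
    r + q * d ≡ r′ + q′ * d → q ≡ q′ × r ≡ r′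
  divMod-injective {d} {q} {q′} {r} {r′} r<d r′<d eq =
    sym (proj₁ (divMod-unique q r r<d)) ∙ cong (_/ d) eq ∙ proj₁ (divMod-unique q′ r′ r′<d) ,
    sym (proj₂ (divMod-unique q r r<d)) ∙ cong (_% d) eq ∙ proj₂ (divMod-unique q′ r′ r′<d)

  mixed-radix-< : ∀ {x y p q} → x < p → y < q → x * q + y < p * q
  mixed-radix-< {x} {y} {p} {q} x<p y<q = begin-strict
    x * q + y   <⟨ +-monoʳ-< (x * q) y<q ⟩
    x * q + q   ≡⟨ +-comm (x * q) q ⟩
    suc x * q   ≤⟨ *-monoˡ-≤ q x<p ⟩
    p * q       ∎
    where open ≤-Reasoning

  -- Inside each block of a * b consecutive numbers swap the two digits of the mixed-radix
  -- representation: k * (a * b) + (w * b + u) ↦ k * (a * b) + (u * a + w).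
  module Transpose (a b : ℕ) .{{_ : NonZero a}} .{{_ : NonZero b}} where

    instance
      ab≢0 : NonZero (a * b)
      ab≢0 = m*n≢0 a b

    block high low : ℕ → ℕ
    block n = n / (a * b)
    high n = n % (a * b) / b
    low n = n % (a * b) % b

    transpose : ℕ → ℕ
    transpose n = block n * (a * b) + (low n * a + high n)

    digits : ∀ n → n ≡ block n * (a * b) + (high n * b + low n)
    digits n = m≡m%n+[m/n]*n n (a * b) ∙ +-comm _ (block n * (a * b))
             ∙ cong (block n * (a * b) +_) (m≡m%n+[m/n]*n (n % (a * b)) b ∙ +-comm (low n) (high n * b))

    high-< : ∀ n → high n < a
    high-< n = m<n*o⇒m/o<n {n % (a * b)} {a} {b} (m%n<n n (a * b))

    low-< : ∀ n → low n < b
    low-< n = m%n<n (n % (a * b)) b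

    transposed-< : ∀ n → low n * a + high n < a * b
    transposed-< n = subst (low n * a + high n <_) (*-comm b a) (mixed-radix-< (low-< n) (high-< n))

    transpose-< : ∀ {f n} → n < f * (a * b) → transpose n < f * (a * b)
    transpose-< {f} {n} n<f*ab = begin-strict
      block n * (a * b) + (low n * a + high n)   <⟨ +-monoʳ-< _ (transposed-< n) ⟩
      block n * (a * b) + a * b                  ≡⟨ +-comm (block n * (a * b)) (a * b) ⟩
      suc (block n) * (a * b)                    ≤⟨ *-monoˡ-≤ (a * b) (m<n*o⇒m/o<n {n} {f} {a * b} n<f*ab) ⟩
      f * (a * b)                                ∎
      where open ≤-Reasoning

    transpose-digits : ∀ k w u → w < a → u < b → transpose (k * (a * b) + (w * b + u)) ≡ k * (a * b) + (u * a + w)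
    transpose-digits k w u w<a u<b
      rewrite +-comm (k * (a * b)) (w * b + u)
            | proj₁ (divMod-unique k (w * b + u) (mixed-radix-< w<a u<b))
            | proj₂ (divMod-unique k (w * b + u) (mixed-radix-< w<a u<b))
            | +-comm (w * b) u
            | proj₁ (divMod-unique w u u<b)
            | proj₂ (divMod-unique w u u<b) = refl

    transpose-injective : ∀ {n n′} → transpose n ≡ transpose n′ → n ≡ n′
    transpose-injective {n} {n′} eq = begin
      n                                               ≡⟨ digits n ⟩
      block n * (a * b) + (high n * b + low n)
        ≡⟨ cong₂ (λ k x → k * (a * b) + x) same-block (cong₂ (λ x y → x * b + y) same-high same-low) ⟩
      block n′ * (a * b) + (high n′ * b + low n′)     ≡⟨ digits n′ ⟨
      n′                                              ∎
      where
      open ≡-Reasoning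
      blocks : block n ≡ block n′ × low n * a + high n ≡ low n′ * a + high n′
      blocks = divMod-injective (transposed-< n) (transposed-< n′)
        (+-comm (low n * a + high n) _ ∙ eq ∙ +-comm _ (low n′ * a + high n′))
      same-block : block n ≡ block n′
      same-block = proj₁ blocks
      same-digits : low n ≡ low n′ × high n ≡ high n′
      same-digits = divMod-injective (high-< n) (high-< n′)
        (+-comm (high n) (low n * a) ∙ proj₂ blocks ∙ +-comm (low n′ * a) (high n′))
      same-low : low n ≡ low n′
      same-low = proj₁ same-digits
      same-high : high n ≡ high n′
      same-high = proj₂ same-digits

module Solutions (a b m : ℕ) .{{_ : NonZero a}} .{{_ : NonZero b}} where

  open import Data.Nat

  open Matching
  open Residues using (_≡_modulo_; ≡-mod⇒∣∸)
  open import Data.Nat.Properties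
  open import Data.Nat.DivMod using (m*[n/m]≡n)
  open import Data.Nat.Divisibility using (_∣_; _∣?_; divides)
  open import Data.Bool using (Bool; true; false; T; _∧_)
  open import Data.Product using (_,_; proj₁; proj₂)
  open import Data.Sum using (inj₁; inj₂)
  open import Data.Unit using (tt)
  open import Relation.Nullary using (yes; no; does)
  open import Relation.Binary.PropositionalEquality

  Solution : Edge → Set
  Solution (x , y) = a * x + b * y ≡ m

  solvable : (c d x : ℕ) → Bool
  solvable c d x = (c * x ≤ᵇ m) ∧ does (d ∣? (m ∸ c * x))

  solvable-sound : ∀ c d x .{{_ : NonZero d}} → T (solvable c d x) → c * x + d * ((m ∸ c * x) / d) ≡ m
  solvable-sound c d x sol with c * x ≤ᵇ m in le | d ∣? (m ∸ c * x)
  ... | true | yes d∣ = cong (c * x +_) (m*[n/m]≡n d∣) ∙ m+[n∸m]≡n (≤ᵇ⇒≤ (c * x) m (subst T (sym le) tt))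

  solvable-complete : ∀ c d x y → c * x + d * y ≡ m → T (solvable c d x)
  solvable-complete c d x y eq with c * x ≤ᵇ m in le | d ∣? (m ∸ c * x)
  ... | false | _     = subst T le (≤⇒≤ᵇ (subst (c * x ≤_) eq (m≤m+n (c * x) (d * y))))
  ... | true  | yes _ = tt
  ... | true  | no ∤  = ∤ (divides y (cong (_∸ c * x) (sym eq) ∙ m+n∸m≡n (c * x) (d * y) ∙ *-comm d y))

  solvable-modulo : ∀ c d x → c * x ≡ m modulo d → c * x ≤ m → T (solvable c d x)
  solvable-modulo c d x cx≡m cx≤m with c * x ≤ᵇ m in le | d ∣? (m ∸ c * x)
  ... | false | _     = subst T le (≤⇒≤ᵇ cx≤m)
  ... | true  | yes _ = tt
  ... | true  | no ∤  = ∤ (≡-mod⇒∣∸ cx≡m)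

  isX : ℕ → Bool
  isX = solvable a b

  isY : ℕ → Bool
  isY = solvable b a

  partnerʸ : ℕ → ℕ
  partnerʸ x = (m ∸ a * x) / b

  partnerˣ : ℕ → ℕ
  partnerˣ y = (m ∸ b * y) / a

  isX-sound : ∀ x → T (isX x) → Solution (x , partnerʸ x)
  isX-sound x = solvable-sound a b x

  isY-sound : ∀ y → T (isY y) → Solution (partnerˣ y , y)
  isY-sound y sol = +-comm (a * partnerˣ y) (b * y) ∙ solvable-sound b a y sol

  isX-complete : ∀ x y → Solution (x , y) → T (isX x)
  isX-complete x y = solvable-complete a b x y

  isY-complete : ∀ x y → Solution (x , y) → T (isY y)
  isY-complete x y eq = solvable-complete b a y x (+-comm (b * y) (a * x) ∙ eq)

  same-x⇒same-y : ∀ {x y y′} → Solution (x , y) → Solution (x , y′) → y ≡ y′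
  same-x⇒same-y {x} eq eq′ = *-cancelˡ-≡ _ _ b (+-cancelˡ-≡ (a * x) _ _ (eq ∙ sym eq′))

  same-y⇒same-x : ∀ {x x′ y} → Solution (x , y) → Solution (x′ , y) → x ≡ x′
  same-y⇒same-x {y = y} eq eq′ = *-cancelˡ-≡ _ _ a (+-cancelʳ-≡ (b * y) _ _ (eq ∙ sym eq′))

  small-x⇒x≤y : ∀ {x y} → Solution (x , y) → (a + b) * x ≤ m → x ≤ y
  small-x⇒x≤y {x} {y} eq small = *-cancelˡ-≤ b (+-cancelˡ-≤ (a * x) _ _ (begin
    a * x + b * x   ≡⟨ *-distribʳ-+ x a b ⟨
    (a + b) * x     ≤⟨ small ⟩
    m               ≡⟨ eq ⟨
    a * x + b * y   ∎))
    where open ≤-Reasoning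

  small-x⇒large-y : ∀ {x y} → Solution (x , y) → (a + b) * x ≤ m → m ≤ (a + b) * y
  small-x⇒large-y {x} {y} eq small = begin
    m               ≡⟨ eq ⟨
    a * x + b * y   ≤⟨ +-monoˡ-≤ (b * y) (*-monoʳ-≤ a (small-x⇒x≤y eq small)) ⟩
    a * y + b * y   ≡⟨ *-distribʳ-+ y a b ⟨
    (a + b) * y     ∎
    where open ≤-Reasoning

  small-y⇒y<x : ∀ {x y} → Solution (x , y) → (a + b) * y < m → y < x
  small-y⇒y<x {x} {y} eq small = *-cancelˡ-< a _ _ (+-cancelʳ-< (b * y) _ _ (begin-strict
    a * y + b * y   ≡⟨ *-distribʳ-+ y a b ⟨
    (a + b) * y     <⟨ small ⟩
    m               ≡⟨ eq ⟨
    a * x + b * y   ∎))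
    where open ≤-Reasoning

  small-y⇒large-x : ∀ {x y} → Solution (x , y) → (a + b) * y < m → m < (a + b) * x
  small-y⇒large-x {x} {y} eq small = begin-strict
    m               ≡⟨ eq ⟨
    a * x + b * y   <⟨ +-monoʳ-< (a * x) (*-monoʳ-< b (small-y⇒y<x eq small)) ⟩
    a * x + b * x   ≡⟨ *-distribʳ-+ x a b ⟨
    (a + b) * x     ∎
    where open ≤-Reasoning

  small-x-crossing : ∀ {x y x′ y′} → Solution (x , y) → Solution (x′ , y′) →
    (a + b) * x ≤ m → (a + b) * x′ ≤ m → x ≡ y′ → x ≡ x′
  small-x-crossing {x} {y} {x′} eq eq′ small small′ refl = ≤-antisym x≤x′ x′≤x
    where
    x′≤x : x′ ≤ x
    x′≤x = small-x⇒x≤y eq′ small′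
    x≤x′ : x ≤ x′
    x≤x′ = *-cancelˡ-≤ a (+-cancelʳ-≤ (b * x) _ _ (begin
      a * x + b * x   ≡⟨ *-distribʳ-+ x a b ⟨
      (a + b) * x     ≤⟨ small ⟩
      m               ≡⟨ eq′ ⟨
      a * x′ + b * x  ∎))
      where open ≤-Reasoning

  solutions-matching : ∀ E G N → (∀ i → i < N → Solution (E i)) →
    (∀ {i j} → i < N → j < N → T (G i) → T (G j) → proj₁ (E i) ≡ proj₁ (E j) → i ≡ j) →
    (∀ {i j} → i < N → j < N → T (G i) → T (G j) → proj₁ (E i) ≡ proj₂ (E j) → i ≡ j) →
    IsMatching E G N
  solutions-matching E G N sol x-inj xy-inj i<N j<N Gi Gj (inj₁ vi) (inj₁ vj) =
    x-inj i<N j<N Gi Gj (sym vi ∙ vj)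
  solutions-matching E G N sol x-inj xy-inj i<N j<N Gi Gj (inj₁ vi) (inj₂ vj) =
    xy-inj i<N j<N Gi Gj (sym vi ∙ vj)
  solutions-matching E G N sol x-inj xy-inj i<N j<N Gi Gj (inj₂ vi) (inj₁ vj) =
    sym (xy-inj j<N i<N Gj Gi (sym vj ∙ vi))
  solutions-matching E G N sol x-inj xy-inj i<N j<N Gi Gj (inj₂ vi) (inj₂ vj) =
    x-inj i<N j<N Gi Gj (same-y⇒same-x (sol _ i<N) (subst (λ y → Solution (proj₁ (E _) , y)) (sym vj ∙ vi) (sol _ j<N)))

module Edges (a b m : ℕ) .{{_ : NonZero a}} .{{_ : NonZero b}} (a⊥b : Coprime a b) where

  open import Data.Nat

  open import Defs using (countIn)
  open Counting
  open Matching
  open Residues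
  open Solutions a b m
  open Transpose a b
  open import Data.Nat.Properties
  import Data.Nat.Coprimality as Coprimality
  open import Data.Nat.Divisibility using (_∣_)
  open import Data.Nat.Tactic.RingSolver using (solve-∀)
  open import Data.Bool using (Bool; true; false; T; not; _∧_)
  open import Data.Bool.Properties using (∧-identityʳ)
  open import Data.Product using (_×_; _,_; proj₁; proj₂; ∃)
  open import Data.Sum using (inj₁; inj₂)
  open import Data.Empty using (⊥; ⊥-elim)
  open import Data.Unit using (tt)
  open import Function using (_∘_)
  open import Relation.Nullary using (¬_)
  open import Relation.Binary.PropositionalEquality

  -- Opaque so that unification never unfolds the Bézout computation behind ρ and σ.
  opaque
    ρ-spec : ∃ λ ρ → 1 ≤ ρ × ρ ≤ b × a * ρ ≡ m modulo b
    ρ-spec = positive-representative {a} {b} (proj₂ (linear-congruence-solvable m a⊥b))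

    σ-spec : ∃ λ σ → 1 ≤ σ × σ ≤ a × b * σ ≡ m modulo a
    σ-spec = positive-representative {b} {a} (proj₂ (linear-congruence-solvable m (Coprimality.sym a⊥b)))

  ρ : ℕ
  ρ = proj₁ ρ-spec

  σ : ℕ
  σ = proj₁ σ-spec

  ρ-positive : 1 ≤ ρ
  ρ-positive = proj₁ (proj₂ ρ-spec)

  ρ≤b : ρ ≤ b
  ρ≤b = proj₁ (proj₂ (proj₂ ρ-spec))

  aρ≡m : a * ρ ≡ m modulo b
  aρ≡m = proj₂ (proj₂ (proj₂ ρ-spec))

  σ-positive : 1 ≤ σ
  σ-positive = proj₁ (proj₂ σ-spec)

  σ≤a : σ ≤ a
  σ≤a = proj₁ (proj₂ (proj₂ σ-spec))

  bσ≡m : b * σ ≡ m modulo a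
  bσ≡m = proj₂ (proj₂ (proj₂ σ-spec))

  firstX : ℕ → ℕ
  firstX i = ρ + b * i

  first : ℕ → Edge
  first i = firstX i , partnerʸ (firstX i)

  first-solution : ∀ i → (a + b) * firstX i ≤ m → Solution (first i)
  first-solution i small = isX-sound (firstX i) (solvable-modulo a b (firstX i) ax≡m (≤-trans a*x≤ small))
    where
    ax≡m : a * firstX i ≡ m modulo b
    ax≡m = *-≡-mod-shift {a} {ρ} i aρ≡m
    a*x≤ : a * firstX i ≤ (a + b) * firstX i
    a*x≤ = *-monoˡ-≤ (firstX i) (m≤m+n a b)

  first-small : ∀ f {i} → (a + b) * (b * f) ≤ m → i < f → (a + b) * firstX i ≤ m
  first-small f {i} bound i<f = begin
    (a + b) * (ρ + b * i)   ≤⟨ *-monoʳ-≤ (a + b) (+-monoˡ-≤ (b * i) ρ≤b) ⟩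
    (a + b) * (b + b * i)   ≡⟨ cong ((a + b) *_) (*-suc b i) ⟨
    (a + b) * (b * suc i)   ≤⟨ *-monoʳ-≤ (a + b) (*-monoʳ-≤ b i<f) ⟩
    (a + b) * (b * f)       ≤⟨ bound ⟩
    m                       ∎
    where open ≤-Reasoning

  firstX-positive : ∀ i → 1 ≤ firstX i
  firstX-positive i = ≤-trans ρ-positive (m≤m+n ρ (b * i))

  -- Second kind: the solutions y = σ + a ν on the small-y side, where ν = transpose n
  -- runs through the same blocks as n.

  secondY : ℕ → ℕ
  secondY n = σ + a * transpose n

  second : ℕ → Edge
  second n = partnerˣ (secondY n) , secondY n

  second-solution : ∀ n → (a + b) * secondY n < m → Solution (second n)
  second-solution n small = isY-sound (secondY n) (solvable-modulo b a (secondY n) by≡m (<⇒≤ (≤-<-trans b*y≤ small)))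
    where
    by≡m : b * secondY n ≡ m modulo a
    by≡m = *-≡-mod-shift {b} {σ} (transpose n) bσ≡m
    b*y≤ : b * secondY n ≤ (a + b) * secondY n
    b*y≤ = *-monoˡ-≤ (secondY n) (m≤n+m b a)

  second-small : ∀ f {n} → (a + b) * (a * (f * (a * b))) < m → n < f * (a * b) → (a + b) * secondY n < m
  second-small f {n} bound n<f*ab = begin-strict
    (a + b) * (σ + a * transpose n)   ≤⟨ *-monoʳ-≤ (a + b) (+-monoˡ-≤ (a * transpose n) σ≤a) ⟩
    (a + b) * (a + a * transpose n)   ≡⟨ cong ((a + b) *_) (*-suc a (transpose n)) ⟨
    (a + b) * (a * suc (transpose n)) ≤⟨ *-monoʳ-≤ (a + b) (*-monoʳ-≤ a (transpose-< {f} n<f*ab)) ⟩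
    (a + b) * (a * (f * (a * b)))     <⟨ bound ⟩
    m                                 ∎
    where open ≤-Reasoning

  secondY-positive : ∀ n → 1 ≤ secondY n
  secondY-positive n = ≤-trans σ-positive (m≤m+n σ (a * transpose n))

  -- An isolated edge shares no vertex with any other solution.
  isolated : ℕ → Bool
  isolated n = not (isX (secondY n)) ∧ not (isY (proj₁ (second n)))

  isolated⇒ : ∀ {n} → T (isolated n) → ¬ T (isX (secondY n)) × ¬ T (isY (proj₁ (second n)))
  isolated⇒ {n} = split (isX (secondY n)) (isY (proj₁ (second n)))
    where
    split : ∀ x y → T (not x ∧ not y) → ¬ T x × ¬ T y
    split false false _ = (λ ()) , (λ ())

  module _ (f₁ : ℕ) (first-bound : (a + b) * (b * f₁) ≤ m) where

    first-matching : IsMatching first (λ _ → true) f₁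
    first-matching = solutions-matching first (λ _ → true) f₁ sol x-injective xy-injective
      where
      small : ∀ {i} → i < f₁ → (a + b) * firstX i ≤ m
      small = first-small f₁ first-bound
      sol : ∀ i → i < f₁ → Solution (first i)
      sol i i<f = first-solution i (small i<f)
      x-injective : ∀ {i j} → i < f₁ → j < f₁ → T true → T true → firstX i ≡ firstX j → i ≡ j
      x-injective _ _ _ _ eq = *-cancelˡ-≡ _ _ b (+-cancelˡ-≡ ρ _ _ eq)
      xy-injective : ∀ {i j} → i < f₁ → j < f₁ → T true → T true → firstX i ≡ partnerʸ (firstX j) → i ≡ j
      xy-injective i<f j<f _ _ eq =
        x-injective i<f j<f tt tt (small-x-crossing (sol _ i<f) (sol _ j<f) (small i<f) (small j<f) eq)

  module _ (f₂ : ℕ) (second-bound : (a + b) * (a * (f₂ * (a * b))) < m) where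

    second-matching : IsMatching second isolated (f₂ * (a * b))
    second-matching = solutions-matching second isolated (f₂ * (a * b)) sol x-injective xy-injective
      where
      small : ∀ {n} → n < f₂ * (a * b) → (a + b) * secondY n < m
      small = second-small f₂ second-bound
      sol : ∀ n → n < f₂ * (a * b) → Solution (second n)
      sol n n<N = second-solution n (small n<N)
      x-injective : ∀ {i j} → i < f₂ * (a * b) → j < f₂ * (a * b) → T (isolated i) → T (isolated j) →
        proj₁ (second i) ≡ proj₁ (second j) → i ≡ j
      x-injective {i} {j} i<N j<N _ _ eq = transpose-injective (*-cancelˡ-≡ _ _ a (+-cancelˡ-≡ σ _ _ same-y))
        where
        same-y : secondY i ≡ secondY j
        same-y = same-x⇒same-y (sol i i<N) (subst (λ x → Solution (x , secondY j)) (sym eq) (sol j j<N))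
      xy-injective : ∀ {i j} → i < f₂ * (a * b) → j < f₂ * (a * b) → T (isolated i) → T (isolated j) →
        proj₁ (second i) ≡ secondY j → i ≡ j
      xy-injective {i} {j} i<N j<N _ _ eq = ⊥-elim (<-asym (small j<N)
        (subst (λ y → m < (a + b) * y) eq (small-y⇒large-x (sol i i<N) (small i<N))))

    module _ (f₁ : ℕ) (first-bound : (a + b) * (b * f₁) ≤ m) where

      first-second-apart : ∀ {i j v} → i < f₁ → j < f₂ * (a * b) → T true → T (isolated j) →
        Endpoint (first i) v → Endpoint (second j) v → ⊥
      first-second-apart {i} {j} i<f j<N _ Ij = apart
        where
        small₁ : (a + b) * firstX i ≤ m
        small₁ = first-small f₁ first-bound i<f
        small₂ : (a + b) * secondY j < m
        small₂ = second-small f₂ second-bound j<N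
        sol₁ : Solution (first i)
        sol₁ = first-solution i small₁
        sol₂ : Solution (second j)
        sol₂ = second-solution j small₂
        apart : ∀ {v} → Endpoint (first i) v → Endpoint (second j) v → ⊥
        apart (inj₁ refl) (inj₁ x≡x) = <⇒≱ (small-y⇒large-x sol₂ small₂) (subst (λ x → (a + b) * x ≤ m) x≡x small₁)
        apart (inj₁ refl) (inj₂ x≡y) = proj₁ (isolated⇒ Ij) (subst (T ∘ isX) x≡y (isX-complete _ _ sol₁))
        apart (inj₂ refl) (inj₁ y≡x) = proj₂ (isolated⇒ Ij) (subst (T ∘ isY) y≡x (isY-complete _ _ sol₁))
        apart (inj₂ refl) (inj₂ y≡y) = <⇒≱ small₂ (subst (λ y → m ≤ (a + b) * y) y≡y (small-x⇒large-y sol₁ small₁))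

  b-cancels-a : ∀ e → b ∣ a * e → b ∣ e
  b-cancels-a e = Coprimality.coprime-divisor (Coprimality.sym a⊥b)

  a-cancels-b : ∀ e → a ∣ b * e → a ∣ e
  a-cancels-b e = Coprimality.coprime-divisor a⊥b

  -- Within a row w of a block, u is pinned down by a³ u modulo b …
  row-isX-unique : ∀ B w {u u′} → u < b → u′ < b →
    T (isX (σ + a * (B + (u * a + w)))) → T (isX (σ + a * (B + (u′ * a + w)))) → u ≡ u′
  row-isX-unique B w {u} {u′} u<b u′<b isXu isXu′ =
    residue-unique (a * a * a) cancel u<b u′<b (+-cancelʳ-≡ C _ _
      (expand u z ∙ isX-sound _ isXu ∙ sym (isX-sound _ isXu′) ∙ sym (expand u′ z′)))
    where
    C z z′ : ℕ
    C = a * σ + a * a * B + a * a * w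
    z = partnerʸ (σ + a * (B + (u * a + w)))
    z′ = partnerʸ (σ + a * (B + (u′ * a + w)))
    expand : ∀ u z → a * a * a * u + b * z + C ≡ a * (σ + a * (B + (u * a + w))) + b * z
    expand u z = ring a b σ B w u z
      where
      ring : ∀ a b σ B w u z → a * a * a * u + b * z + (a * σ + a * a * B + a * a * w)
                             ≡ a * (σ + a * (B + (u * a + w))) + b * z
      ring = solve-∀
    cancel : ∀ e → b ∣ a * a * a * e → b ∣ e
    cancel e b∣ = b-cancels-a e (b-cancels-a (a * e) (b-cancels-a (a * (a * e))
      (subst (b ∣_) (*-assoc (a * a) a e ∙ *-assoc a a (a * e)) b∣)))

  -- … and a row whose x-coordinate is also a y-coordinate is pinned down by a b² w modulo a².
  isY-row-unique : ∀ B {w w′ u u′ x x′} → w < a → w′ < a →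
    Solution (x , σ + a * (B + (u * a + w))) → T (isY x) →
    Solution (x′ , σ + a * (B + (u′ * a + w′))) → T (isY x′) → w ≡ w′
  isY-row-unique B {w} {w′} {u} {u′} {x} {x′} w<a w′<a sol isYx sol′ isYx′ =
    residue-unique (b * b) a-cancels-b² w<a w′<a (*-cancelˡ-≡ _ _ a (+-cancelʳ-≡ Q _ _ (begin
      a * (b * b * w + a * (z′ + b * b * u)) + Q     ≡⟨ expand u w z′ ⟩
      b * b * y + (a * a * z′ + b * m)              ≡⟨ cong (b * b * y +_) (eliminate sol′ (isY-sound x′ isYx′)) ⟩
      b * b * y + (a * m + b * b * y′)              ≡⟨ swap (b * b * y) (a * m) (b * b * y′) ⟩
      b * b * y′ + (a * m + b * b * y)              ≡⟨ cong (b * b * y′ +_) (eliminate sol (isY-sound x isYx)) ⟨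
      b * b * y′ + (a * a * z + b * m)              ≡⟨ expand u′ w′ z ⟨
      a * (b * b * w′ + a * (z + b * b * u′)) + Q   ∎)))
    where
    open ≡-Reasoning
    y y′ z z′ Q : ℕ
    y = σ + a * (B + (u * a + w))
    y′ = σ + a * (B + (u′ * a + w′))
    z = partnerˣ x
    z′ = partnerˣ x′
    Q = b * m + b * b * σ + a * b * b * B
    eliminate : ∀ {x y z} → a * x + b * y ≡ m → a * z + b * x ≡ m → a * a * z + b * m ≡ a * m + b * b * y
    eliminate {x} {y} {z} xy zx = begin
      a * a * z + b * m                    ≡⟨ cong (λ k → a * a * z + b * k) xy ⟨
      a * a * z + b * (a * x + b * y)      ≡⟨ ring a b x y z ⟩
      a * (a * z + b * x) + b * b * y      ≡⟨ cong (λ k → a * k + b * b * y) zx ⟩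
      a * m + b * b * y                    ∎
      where
      ring : ∀ a b x y z → a * a * z + b * (a * x + b * y) ≡ a * (a * z + b * x) + b * b * y
      ring = solve-∀
    expand : ∀ u w z → a * (b * b * w + a * (z + b * b * u)) + Q ≡ b * b * (σ + a * (B + (u * a + w))) + (a * a * z + b * m)
    expand u w z = ring a b m σ B u w z
      where
      ring : ∀ a b m σ B u w z → a * (b * b * w + a * (z + b * b * u)) + (b * m + b * b * σ + a * b * b * B)
                               ≡ b * b * (σ + a * (B + (u * a + w))) + (a * a * z + b * m)
      ring = solve-∀
    swap : ∀ p q r → p + (q + r) ≡ r + (q + p)
    swap = solve-∀
    a-cancels-b² : ∀ e → a ∣ b * b * e → a ∣ e
    a-cancels-b² e a∣ = a-cancels-b e (a-cancels-b (b * e) (subst (a ∣_) (*-assoc b b e) a∣))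

  module _ (f₂ : ℕ) (second-bound : (a + b) * (a * (f₂ * (a * b))) < m) where

    module Block {k : ℕ} (k<f₂ : k < f₂) where

      cell : ℕ → ℕ → ℕ
      cell w u = k * (a * b) + (w * b + u)

      y-isX x-isY : ℕ → ℕ → Bool
      y-isX w u = isX (secondY (cell w u))
      x-isY w u = isY (proj₁ (second (cell w u)))

      secondY-cell : ∀ {w u} → w < a → u < b → secondY (cell w u) ≡ σ + a * (k * (a * b) + (u * a + w))
      secondY-cell {w} {u} w<a u<b = cong (λ ν → σ + a * ν) (transpose-digits k w u w<a u<b)

      solution-cell : ∀ {w u} → w < a → u < b →
        Solution (proj₁ (second (cell w u)) , σ + a * (k * (a * b) + (u * a + w)))
      solution-cell {w} {u} w<a u<b = subst (λ y → Solution (proj₁ (second (cell w u)) , y)) (secondY-cell w<a u<b)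
        (second-solution _ (second-small f₂ second-bound (mixed-radix-< k<f₂ (mixed-radix-< w<a u<b))))

      Clean : ℕ → Set
      Clean w = count (x-isY w) b ≡ 0

      clean-row-count : ∀ {w} → w < a → Clean w → b ∸ 1 ≤ count (row (row isolated (a * b) k) b w) b
      clean-row-count {w} w<a clean = begin
        b ∸ 1                              ≤⟨ ∸-monoˡ-≤ 1 (count-not-atMostOne (y-isX w) b at-most-one) ⟩
        count (not ∘ y-isX w) b + 1 ∸ 1    ≡⟨ m+n∸n≡m _ 1 ⟩
        count (not ∘ y-isX w) b            ≡⟨ count-cong b isolated-cell ⟩
        count (row (row isolated (a * b) k) b w) b ∎
        where
        open ≤-Reasoning
        at-most-one : AtMostOne (T ∘ y-isX w) b
        at-most-one u<b u′<b isXu isXu′ = row-isX-unique (k * (a * b)) w u<b u′<b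
          (subst (T ∘ isX) (secondY-cell w<a u<b) isXu) (subst (T ∘ isX) (secondY-cell w<a u′<b) isXu′)
        isolated-cell : ∀ u → u < b → not (y-isX w u) ≡ isolated (cell w u)
        isolated-cell u u<b with x-isY w u | count≡0⇒none (x-isY w) b clean u<b
        ... | false | _   = sym (∧-identityʳ _)
        ... | true  | ¬xy = ⊥-elim (¬xy tt)

      unclean-rows : AtMostOne (¬_ ∘ Clean) a
      unclean-rows w<a w′<a unclean unclean′ with count≢0⇒some _ b unclean | count≢0⇒some _ b unclean′
      ... | u , u<b , xy | u′ , u′<b , xy′ =
        isY-row-unique (k * (a * b)) {u = u} {u′} w<a w′<a (solution-cell w<a u<b) xy (solution-cell w′<a u′<b) xy′

    block-count : ∀ {k} → k < f₂ → (a ∸ 1) * (b ∸ 1) ≤ count (row isolated (a * b) k) (a * b)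
    block-count {k} k<f₂ = +-cancelʳ-≤ (b ∸ 1) _ _ (begin
      (a ∸ 1) * (b ∸ 1) + (b ∸ 1)                ≡⟨ +-comm ((a ∸ 1) * (b ∸ 1)) (b ∸ 1) ⟩
      suc (a ∸ 1) * (b ∸ 1)                      ≡⟨ cong (_* (b ∸ 1)) (suc-pred a) ⟩
      a * (b ∸ 1)                                ≤⟨ count-rows-but-one (row isolated (a * b) k) a b (b ∸ 1)
                                                      Clean (λ w → count (x-isY w) b ≟ 0) (λ _ → clean-row-count) unclean-rows ⟩
      count (row isolated (a * b) k) (a * b) + (b ∸ 1) ∎)
      where
      open ≤-Reasoning
      open Block k<f₂

    isolated-count : f₂ * ((a ∸ 1) * (b ∸ 1)) ≤ count isolated (f₂ * (a * b))
    isolated-count = count-rows isolated f₂ (a * b) _ (λ k k<f → block-count k<f)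

  PositiveSolution : Edge → Set
  PositiveSolution (x , y) = Solution (x , y) × 1 ≤ x × 1 ≤ y

  module _ (f₁ f₂ : ℕ) (first-bound : (a + b) * (b * f₁) ≤ m) (second-bound : (a + b) * (a * (f₂ * (a * b))) < m) where

    edge : ℕ → Edge
    edge = first ++[ f₁ ] second

    selected : ℕ → Bool
    selected = (λ _ → true) ++[ f₁ ] isolated

    edge-positive : ∀ i → i < f₁ + f₂ * (a * b) → PositiveSolution (edge i)
    edge-positive = all-++ PositiveSolution first second f₁ (f₂ * (a * b)) first-positive second-positive
      where
      first-positive : ∀ i → i < f₁ → PositiveSolution (first i)
      first-positive i i<f = sol , firstX-positive i , ≤-trans (firstX-positive i) (small-x⇒x≤y sol small)
        where
        small : (a + b) * firstX i ≤ m
        small = first-small f₁ first-bound i<f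
        sol : Solution (first i)
        sol = first-solution i small
      second-positive : ∀ n → n < f₂ * (a * b) → PositiveSolution (second n)
      second-positive n n<N = sol , ≤-trans (secondY-positive n) (<⇒≤ (small-y⇒y<x sol small)) , secondY-positive n
        where
        small : (a + b) * secondY n < m
        small = second-small f₂ second-bound n<N
        sol : Solution (second n)
        sol = second-solution n small

    edge-matching : IsMatching edge selected (f₁ + f₂ * (a * b))
    edge-matching = matching-++ first (λ _ → true) f₁ second isolated (f₂ * (a * b))
      (first-matching f₁ first-bound) (second-matching f₂ second-bound) (first-second-apart f₂ second-bound f₁ first-bound)

    selected-count : f₁ + f₂ * ((a ∸ 1) * (b ∸ 1)) ≤ count selected (f₁ + f₂ * (a * b))
    selected-count = begin
      f₁ + f₂ * ((a ∸ 1) * (b ∸ 1))                      ≤⟨ +-monoʳ-≤ f₁ (isolated-count f₂ second-bound) ⟩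
      f₁ + count isolated (f₂ * (a * b))                 ≡⟨ cong (_+ count isolated (f₂ * (a * b))) (count-all _ f₁ (λ _ _ → tt)) ⟨
      count (λ _ → true) f₁ + count isolated (f₂ * (a * b)) ≡⟨ count-++ (λ _ → true) isolated f₁ (f₂ * (a * b)) ⟨
      count selected (f₁ + f₂ * (a * b))                 ∎
      where open ≤-Reasoning

    solution-free-count : ∀ (S : ℕ → Bool) K →
      (∀ {x y} → 1 ≤ x → 1 ≤ y → Solution (x , y) → x ≤ K × y ≤ K) →
      (∀ {x y} → T (S x) → T (S y) → ¬ Solution (x , y)) →
      f₁ + f₂ * ((a ∸ 1) * (b ∸ 1)) + countIn S K ≤ K
    solution-free-count S K in-range S-free = ≤-trans (+-monoˡ-≤ (countIn S K) selected-count)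
      (matching-count S K edge selected (f₁ + f₂ * (a * b)) edge-matching range not-both)
      where
      range : ∀ {i v} → i < f₁ + f₂ * (a * b) → T (selected i) → Endpoint (edge i) v → 1 ≤ v × v ≤ K
      range {i} i<N _ v with edge-positive i i<N
      ... | sol , x≥1 , y≥1 with v
      ...   | inj₁ refl = x≥1 , proj₁ (in-range x≥1 y≥1 sol)
      ...   | inj₂ refl = y≥1 , proj₂ (in-range x≥1 y≥1 sol)
      not-both : ∀ i → i < f₁ + f₂ * (a * b) → T (selected i) → T (S (proj₁ (edge i))) → ¬ T (S (proj₂ (edge i)))
      not-both i i<N _ Sx Sy = S-free Sx Sy (proj₁ (edge-positive i i<N))

module Fractions where

  open import Defs using (_÷_)
  open import Data.Nat as ℕ using (ℕ; suc; s≤s; z≤n)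
  open import Data.Integer using (ℤ; +_; _*_; _+_; -_; _-_; _≤_)
  open import Data.Integer.Properties
  import Data.Nat.Properties as ℕP
  open import Data.Integer.DivMod using (div-pos-is-/ℕ; [n/ℕd]*d≤n)
  open import Data.Integer.Tactic.RingSolver using (solve-∀)
  open import Data.Rational as ℚ using (ℚ; floor; ceiling; toℚᵘ)
  open import Data.Rational.Properties using (toℚᵘ-homo-+; toℚᵘ-homo‿-; toℚᵘ-homo-*; toℚᵘ-fromℚᵘ)
  open import Data.Rational.Unnormalised as ℚᵘ using (ℚᵘ; mkℚᵘ; _≃_; *≡*)
  open import Relation.Binary.PropositionalEquality

  infix 4 _≐ᵘ_/_ _≐_/_

  _≐ᵘ_/_ : ℚᵘ → ℤ → ℕ → Set
  x ≐ᵘ a / d = ℚᵘ.↥ x * + d ≡ a * ℚᵘ.↧ x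

  _≐_/_ : ℚ → ℤ → ℕ → Set
  x ≐ a / d = toℚᵘ x ≐ᵘ a / d

  ≐ᵘ-resp-≃ : ∀ {x y a d} → x ≃ y → y ≐ᵘ a / d → x ≐ᵘ a / d
  ≐ᵘ-resp-≃ {x@record{}} {y@(mkℚᵘ n _)} {a} {d} (*≡* x≃y) y≐ = *-cancelʳ-≡ _ _ (ℚᵘ.↧ y) (begin
    ℚᵘ.↥ x * + d * ℚᵘ.↧ y       ≡⟨ swap (ℚᵘ.↥ x) (+ d) (ℚᵘ.↧ y) ⟩
    ℚᵘ.↥ x * ℚᵘ.↧ y * + d       ≡⟨ cong (_* + d) x≃y ⟩
    n * ℚᵘ.↧ x * + d            ≡⟨ swap n (ℚᵘ.↧ x) (+ d) ⟩
    n * + d * ℚᵘ.↧ x            ≡⟨ cong (_* ℚᵘ.↧ x) y≐ ⟩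
    a * ℚᵘ.↧ y * ℚᵘ.↧ x         ≡⟨ swap a (ℚᵘ.↧ y) (ℚᵘ.↧ x) ⟩
    a * ℚᵘ.↧ x * ℚᵘ.↧ y         ∎)
    where
    open ≡-Reasoning
    swap : ∀ x y z → x * y * z ≡ x * z * y
    swap = solve-∀

  ≐ᵘ-neg : ∀ {x a d} → x ≐ᵘ a / d → ℚᵘ.- x ≐ᵘ - a / d
  ≐ᵘ-neg {mkℚᵘ n _} {a} {d} x≐ = sym (neg-distribˡ-* n (+ d)) ∙ cong -_ x≐ ∙ neg-distribˡ-* a _

  ≐ᵘ-+ : ∀ {x y a b d e} → x ≐ᵘ a / d → y ≐ᵘ b / e → x ℚᵘ.+ y ≐ᵘ a * + e + b * + d / d ℕ.* e
  ≐ᵘ-+ {mkℚᵘ n dx} {mkℚᵘ n′ dy} {a} {b} {d} {e} x≐ y≐ = begin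
    (n * ↧y + n′ * ↧x) * + (d ℕ.* e)               ≡⟨ cong ((n * ↧y + n′ * ↧x) *_) (pos-* d e) ⟩
    (n * ↧y + n′ * ↧x) * (+ d * + e)               ≡⟨ expand n ↧y n′ ↧x (+ d) (+ e) ⟩
    (n * + d) * (↧y * + e) + (n′ * + e) * (↧x * + d) ≡⟨ cong₂ (λ u v → u * (↧y * + e) + v * (↧x * + d)) x≐ y≐ ⟩
    (a * ↧x) * (↧y * + e) + (b * ↧y) * (↧x * + d)  ≡⟨ collect a ↧x ↧y (+ e) b (+ d) ⟩
    (a * + e + b * + d) * (↧x * ↧y)                ≡⟨ cong ((a * + e + b * + d) *_) (pos-* (suc dx) (suc dy)) ⟨
    (a * + e + b * + d) * + (suc dx ℕ.* suc dy)    ∎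
    where
    open ≡-Reasoning
    ↧x = + suc dx
    ↧y = + suc dy
    expand : ∀ n dy n′ dx d e → (n * dy + n′ * dx) * (d * e) ≡ (n * d) * (dy * e) + (n′ * e) * (dx * d)
    expand = solve-∀
    collect : ∀ a dx dy e b d → (a * dx) * (dy * e) + (b * dy) * (dx * d) ≡ (a * e + b * d) * (dx * dy)
    collect = solve-∀

  ≐ᵘ-* : ∀ {x y a b d e} → x ≐ᵘ a / d → y ≐ᵘ b / e → x ℚᵘ.* y ≐ᵘ a * b / d ℕ.* e
  ≐ᵘ-* {mkℚᵘ n dx} {mkℚᵘ n′ dy} {a} {b} {d} {e} x≐ y≐ = begin
    (n * n′) * + (d ℕ.* e)        ≡⟨ cong ((n * n′) *_) (pos-* d e) ⟩
    (n * n′) * (+ d * + e)        ≡⟨ interchange n n′ (+ d) (+ e) ⟩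
    (n * + d) * (n′ * + e)        ≡⟨ cong₂ _*_ x≐ y≐ ⟩
    (a * ↧x) * (b * ↧y)           ≡⟨ interchange a ↧x b ↧y ⟩
    (a * b) * (↧x * ↧y)           ≡⟨ cong ((a * b) *_) (pos-* (suc dx) (suc dy)) ⟨
    (a * b) * + (suc dx ℕ.* suc dy) ∎
    where
    open ≡-Reasoning
    ↧x = + suc dx
    ↧y = + suc dy
    interchange : ∀ p q r s → (p * q) * (r * s) ≡ (p * r) * (q * s)
    interchange = solve-∀

  ≐-÷ : ∀ a d → 1 ℕ.≤ d → a ÷ d ≐ a / d
  ≐-÷ a (suc d-1) _ = ≐ᵘ-resp-≃ {a = a} {d = suc d-1} (toℚᵘ-fromℚᵘ (mkℚᵘ a d-1)) refl

  ≐-neg : ∀ {x a d} → x ≐ a / d → ℚ.- x ≐ - a / d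
  ≐-neg {x} {a} {d} x≐ = ≐ᵘ-resp-≃ {a = - a} {d = d} (toℚᵘ-homo‿- x) (≐ᵘ-neg {toℚᵘ x} {a} {d} x≐)

  ≐-+ : ∀ {x y a b d e} → x ≐ a / d → y ≐ b / e → x ℚ.+ y ≐ a * + e + b * + d / d ℕ.* e
  ≐-+ {x} {y} {a} {b} {d} {e} x≐ y≐ =
    ≐ᵘ-resp-≃ {a = a * + e + b * + d} {d = d ℕ.* e} (toℚᵘ-homo-+ x y) (≐ᵘ-+ {toℚᵘ x} {toℚᵘ y} {a} {b} {d} {e} x≐ y≐)

  ≐-* : ∀ {x y a b d e} → x ≐ a / d → y ≐ b / e → x ℚ.* y ≐ a * b / d ℕ.* e
  ≐-* {x} {y} {a} {b} {d} {e} x≐ y≐ =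
    ≐ᵘ-resp-≃ {a = a * b} {d = d ℕ.* e} (toℚᵘ-homo-* x y) (≐ᵘ-* {toℚᵘ x} {toℚᵘ y} {a} {b} {d} {e} x≐ y≐)

  floor-≐ : ∀ {x a d} → x ≐ a / d → floor x * + d ≤ a
  floor-≐ {x@(ℚ.mkℚ n d-1 _)} {a} {d} x≐ = *-cancelʳ-≤-pos _ _ (+ suc d-1) (begin
    floor x * + d * + suc d-1   ≡⟨ swap (floor x) (+ d) (+ suc d-1) ⟩
    floor x * + suc d-1 * + d   ≤⟨ *-monoʳ-≤-nonNeg (+ d) floor*↧≤↥ ⟩
    n * + d                     ≡⟨ x≐ ⟩
    a * + suc d-1               ∎)
    where
    open ≤-Reasoning
    swap : ∀ x y z → x * y * z ≡ x * z * y
    swap = solve-∀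
    floor*↧≤↥ : floor x * + suc d-1 ≤ n
    floor*↧≤↥ = subst (λ q → q * + suc d-1 ≤ n) (sym (div-pos-is-/ℕ n (suc d-1))) ([n/ℕd]*d≤n n (suc d-1))

  ceiling-≐ : ∀ {x a d} → x ≐ a / d → a ≤ ceiling x * + d
  ceiling-≐ {x@record{}} {a} {d} x≐ = subst₂ _≤_ (neg-involutive a) (neg-distribˡ-* (floor (ℚ.- x)) (+ d))
    (neg-mono-≤ (floor-≐ {ℚ.- x} { - a} {d} (≐-neg {x} {a} {d} x≐)))

  ceiling-÷ : ∀ a d → 1 ℕ.≤ d → a ≤ ceiling (a ÷ d) * + d
  ceiling-÷ a d d≥1 = ceiling-≐ {a ÷ d} {a} {d} (≐-÷ a d d≥1)

  floor-÷ : ∀ a d → 1 ℕ.≤ d → floor (a ÷ d) * + d ≤ a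
  floor-÷ a d d≥1 = floor-≐ {a ÷ d} {a} {d} (≐-÷ a d d≥1)

  floor-÷-minus-÷ : ∀ a d e → 1 ℕ.≤ d → 1 ℕ.≤ e → floor ((a ÷ d) ℚ.- ((+ 1) ÷ e)) * + (d ℕ.* e) ≤ a * + e - + d
  floor-÷-minus-÷ a d e d≥1 e≥1 = subst (floor ((a ÷ d) ℚ.- ((+ 1) ÷ e)) * + (d ℕ.* e) ≤_) (minus (a * + e) (+ d))
    (floor-≐ {(a ÷ d) ℚ.- ((+ 1) ÷ e)} {a * + e + - + 1 * + d} {d ℕ.* e}
      (≐-+ {a ÷ d} {ℚ.- ((+ 1) ÷ e)} {a} { - + 1} {d} {e} (≐-÷ a d d≥1) (≐-neg {(+ 1) ÷ e} {+ 1} {e} (≐-÷ (+ 1) e e≥1))))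
    where
    minus : ∀ x y → x + - + 1 * y ≡ x - y
    minus = solve-∀

  floor-÷1-*-÷ : ∀ w d → 1 ℕ.≤ d → floor ((w ÷ 1) ℚ.* ((+ 1) ÷ d)) * + d ≤ w
  floor-÷1-*-÷ w d d≥1 = subst₂ (λ k v → floor ((w ÷ 1) ℚ.* ((+ 1) ÷ d)) * + k ≤ v) (ℕP.*-identityˡ d) (*-identityʳ w)
    (floor-≐ {(w ÷ 1) ℚ.* ((+ 1) ÷ d)} {w * + 1} {1 ℕ.* d}
      (≐-* {w ÷ 1} {(+ 1) ÷ d} {w} {+ 1} {1} {d} (≐-÷ w 1 (s≤s z≤n)) (≐-÷ (+ 1) d d≥1)))

module Integers where

  open import Data.Nat as ℕ using (ℕ; suc; zero; z≤n)
  import Data.Nat.Properties as ℕP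
  open import Data.Integer using (ℤ; +_; -[1+_]; _*_; _+_; -_; _-_; _≤_; +≤+; -≤+)
  open import Data.Integer.Properties
  open import Data.Integer.Tactic.RingSolver using (solve-∀)
  open import Data.Product using (_×_; _,_; ∃)
  open import Data.Empty using (⊥-elim)
  open import Relation.Binary.PropositionalEquality

  upper-factor-suc : ∀ {A q} (c : ℤ) → 1 ℕ.≤ A → 1 ℕ.≤ q → + A ≤ c * + q → ∃ λ K → c ≡ + suc K × A ℕ.≤ suc K ℕ.* q
  upper-factor-suc {A} {suc q} (+ zero)  A≥1 _ A≤0 = ⊥-elim (ℕP.<⇒≱ A≥1 (drop‿+≤+ A≤0))
  upper-factor-suc {A} {suc q} (+ suc K) _   _ A≤  = K , refl , drop‿+≤+ A≤
  upper-factor-suc {A} {suc q} -[1+ c ]  _   _ ()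

  lower-factor-ℕ : ∀ {A d} (F : ℤ) → F * + d ≤ + A → ∃ λ f → F ≤ + f × f ℕ.* d ℕ.≤ A
  lower-factor-ℕ -[1+ _ ] _   = 0 , -≤+ , z≤n
  lower-factor-ℕ {d = d} (+ f) F≤A = f , ≤-refl , drop‿+≤+ (subst (_≤ _) (sym (pos-* f d)) F≤A)

  nested-lower-factor-ℕ : ∀ {A D E e} (F W : ℤ) → 1 ℕ.≤ A → 1 ℕ.≤ E → 1 ℕ.≤ e →
    F * + D ≤ W → W * + (E ℕ.* e) ≤ + A * + e - + E → ∃ λ f → F ≤ + f × f ℕ.* D ℕ.* E ℕ.< A
  nested-lower-factor-ℕ -[1+ _ ] W A≥1 _ _ _ _ = 0 , -≤+ , A≥1
  nested-lower-factor-ℕ {A} {D} {E} {e} (+ f) W A≥1 E≥1 e≥1 F≤W W≤ = f , ≤-refl , ℕP.*-cancelʳ-< e _ _ fDEe<Ae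
    where
    fDEe+E≤Ae : f ℕ.* D ℕ.* (E ℕ.* e) ℕ.+ E ℕ.≤ A ℕ.* e
    fDEe+E≤Ae = drop‿+≤+ (begin
      + (f ℕ.* D ℕ.* (E ℕ.* e) ℕ.+ E)     ≡⟨ cong (_+ + E) (pos-* (f ℕ.* D) (E ℕ.* e)) ⟩
      + (f ℕ.* D) * + (E ℕ.* e) + + E     ≤⟨ +-monoˡ-≤ (+ E) (≤-trans (*-monoʳ-≤-nonNeg (+ (E ℕ.* e)) fD≤W) W≤) ⟩
      + A * + e - + E + + E               ≡⟨ minus-plus (+ A * + e) (+ E) ⟩
      + A * + e                           ≡⟨ pos-* A e ⟨
      + (A ℕ.* e)                         ∎)
      where
      open ≤-Reasoning
      fD≤W : + (f ℕ.* D) ≤ W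
      fD≤W = subst (_≤ W) (sym (pos-* f D)) F≤W
      minus-plus : ∀ x y → x - y + y ≡ x
      minus-plus = solve-∀
    fDEe<Ae : f ℕ.* D ℕ.* E ℕ.* e ℕ.< A ℕ.* e
    fDEe<Ae = ℕP.<-≤-trans (ℕP.m<m+n _ E≥1)
      (subst (λ x → x ℕ.+ E ℕ.≤ A ℕ.* e) (sym (ℕP.*-assoc (f ℕ.* D) E e)) fDEe+E≤Ae)

  subtract-bounds : ∀ {x K f g} {F G : ℤ} → f ℕ.+ g ℕ.+ x ℕ.≤ K → F ≤ + f → G ≤ + g → + x ≤ + K - F - G
  subtract-bounds {x} {K} {f} {g} {F} {G} count≤K F≤f G≤g = begin
    + x                       ≡⟨ rearrange (+ x) (+ f) (+ g) ⟩
    + (f ℕ.+ g ℕ.+ x) - + f - + g ≤⟨ +-monoˡ-≤ (- + g) (+-monoˡ-≤ (- + f) (+≤+ count≤K)) ⟩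
    + K - + f - + g           ≤⟨ +-mono-≤ (+-monoʳ-≤ (+ K) (neg-mono-≤ F≤f)) (neg-mono-≤ G≤g) ⟩
    + K - F - G               ∎
    where
    open ≤-Reasoning
    rearrange : ∀ x f g → x ≡ f + g + x - f - g
    rearrange = solve-∀

  ab-a-b+1≡[a∸1][b∸1] : ∀ a b → 1 ℕ.≤ a → 1 ℕ.≤ b → + (a ℕ.* b) - + a - + b + + 1 ≡ + ((a ℕ.∸ 1) ℕ.* (b ℕ.∸ 1))
  ab-a-b+1≡[a∸1][b∸1] (suc a) (suc b) _ _ = begin
    + (suc a ℕ.* suc b) - + suc a - + suc b + + 1             ≡⟨ cong (λ v → v - + suc a - + suc b + + 1) (pos-* (suc a) (suc b)) ⟩
    (+ 1 + + a) * (+ 1 + + b) - (+ 1 + + a) - (+ 1 + + b) + + 1 ≡⟨ expand (+ a) (+ b) ⟩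
    + a * + b                                                 ≡⟨ pos-* a b ⟨
    + (a ℕ.* b)                                               ∎
    where
    open ≡-Reasoning
    expand : ∀ x y → (+ 1 + x) * (+ 1 + y) - (+ 1 + x) - (+ 1 + y) + + 1 ≡ x * y
    expand = solve-∀

  scale-nonNeg : ∀ c {F f} → F ≤ + f → + c * F ≤ + (f ℕ.* c)
  scale-nonNeg c {F} {f} F≤f = ≤-trans (*-monoˡ-≤-nonNeg (+ c) F≤f) (≤-reflexive (sym (pos-* c f) ∙ cong +_ (ℕP.*-comm c f)))

module Reduction where

  open import Defs
  open import Data.Nat
  open import Data.Nat.Properties
  open import Data.Nat.GCD using (gcd; GCD; gcd-GCD; GCD-*)
  open import Data.Nat.Coprimality using (Coprime; GCD≡1⇒coprime)
  open import Data.Nat.Tactic.RingSolver using (solve-∀)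
  open import Data.Bool using (T)
  open import Data.Product using (_×_; _,_)
  open import Relation.Nullary using (¬_; contradiction)
  open import Relation.Binary.PropositionalEquality

  coprime-cofactors : ∀ {t r₁ r₂} .{{_ : NonZero t}} → t ≡ gcd (r₁ * t) (r₂ * t) → Coprime r₁ r₂
  coprime-cofactors {t} {r₁} {r₂} t≡gcd = GCD≡1⇒coprime (GCD-* {r₁} {r₂} {1} {t}
    (subst (GCD (r₁ * t) (r₂ * t)) (sym t≡gcd ∙ sym (*-identityˡ t)) (gcd-GCD (r₁ * t) (r₂ * t))))

  L-free-count-bound : ∀ {t r₁ r₂ r k} .{{_ : NonZero t}} .{{_ : NonZero r₁}} .{{_ : NonZero r₂}} →
    Coprime r₁ r₂ → r₂ ≤ r₁ → ∀ {S} → LFree (r₁ * t) (r₂ * t) r S → (k * t) ∈ₛ S →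
    ∀ {K f₁ f₂} → r * (k * t) ≤ suc K * (r₂ * t) →
    f₁ * (r₂ * (r₁ * t + r₂ * t)) ≤ r * (k * t) →
    f₂ * (r₁ * r₂) * (r₁ * (r₁ * t + r₂ * t)) < r * (k * t) →
    f₁ + f₂ * ((r₁ ∸ 1) * (r₂ ∸ 1)) + countIn S K ≤ K
  L-free-count-bound {t} {r₁} {r₂} {r} {k} r₁⊥r₂ r₂≤r₁ {S} free M∈S {K} {f₁} {f₂} A≤ first≤ second< =
    solution-free-count f₁ f₂ first-bound second-bound S K in-range S-free
    where
    open Edges r₁ r₂ (r * k) r₁⊥r₂
    open Solutions r₁ r₂ (r * k) using (Solution)
    m = r * k
    A≡tm : r * (k * t) ≡ t * m
    A≡tm = ring r k t
      where
      ring : ∀ r k t → r * (k * t) ≡ t * (r * k)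
      ring = solve-∀
    scale : ∀ x y → r₁ * t * x + r₂ * t * y ≡ t * (r₁ * x + r₂ * y)
    scale x y = ring r₁ r₂ t x y
      where
      ring : ∀ r₁ r₂ t x y → r₁ * t * x + r₂ * t * y ≡ t * (r₁ * x + r₂ * y)
      ring = solve-∀
    S-free : ∀ {x y} → T (S x) → T (S y) → ¬ Solution (x , y)
    S-free {x} {y} Sx Sy eq = free x y (k * t) Sx Sy M∈S (scale x y ∙ cong (t *_) eq ∙ sym A≡tm)
    in-range : ∀ {x y} → 1 ≤ x → 1 ≤ y → Solution (x , y) → x ≤ K × y ≤ K
    in-range {x} {y} x≥1 y≥1 eq = below x qx<A , below y qy<A
      where
      A = r * (k * t)
      px+qy≡A : r₁ * t * x + r₂ * t * y ≡ A
      px+qy≡A = scale x y ∙ cong (t *_) eq ∙ sym A≡tm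
      positive : ∀ c v → .{{NonZero c}} → 1 ≤ v → 1 ≤ c * v
      positive c v v≥1 = *-mono-≤ (>-nonZero⁻¹ c) v≥1
      qy<A : r₂ * t * y < A
      qy<A = <-≤-trans (m<n+m (r₂ * t * y) (positive (r₁ * t) x {{m*n≢0 r₁ t}} x≥1)) (≤-reflexive px+qy≡A)
      qx<A : r₂ * t * x < A
      qx<A = ≤-<-trans (*-monoˡ-≤ x (*-monoˡ-≤ t r₂≤r₁))
        (<-≤-trans (m<m+n (r₁ * t * x) (positive (r₂ * t) y {{m*n≢0 r₂ t}} y≥1)) (≤-reflexive px+qy≡A))
      below : ∀ v → r₂ * t * v < A → v ≤ K
      below v qv<A = s≤s⁻¹ (*-cancelʳ-< (r₂ * t) v (suc K) (<-≤-trans (subst (_< A) (*-comm (r₂ * t) v) qv<A) A≤))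
    first-bound : (r₁ + r₂) * (r₂ * f₁) ≤ r * k
    first-bound = *-cancelˡ-≤ t (subst₂ _≤_ (ring r₁ r₂ t f₁) A≡tm first≤)
      where
      ring : ∀ r₁ r₂ t f₁ → f₁ * (r₂ * (r₁ * t + r₂ * t)) ≡ t * ((r₁ + r₂) * (r₂ * f₁))
      ring = solve-∀
    second-bound : (r₁ + r₂) * (r₁ * (f₂ * (r₁ * r₂))) < r * k
    second-bound = *-cancelˡ-< t _ _ (subst₂ _<_ (ring r₁ r₂ t f₂) A≡tm second<)
      where
      ring : ∀ r₁ r₂ t f₂ → f₂ * (r₁ * r₂) * (r₁ * (r₁ * t + r₂ * t)) ≡ t * ((r₁ + r₂) * (r₁ * (f₂ * (r₁ * r₂))))
      ring = solve-∀

  factors-positive : ∀ m n → 1 ≤ m * n → 1 ≤ m × 1 ≤ n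
  factors-positive (suc m) (suc n) _    = s≤s z≤n , s≤s z≤n
  factors-positive (suc m) zero    mn≥1 = contradiction (subst (1 ≤_) (*-zeroʳ m) mn≥1) λ ()

open Reduction
open Fractions
open Integers

open import Defs
open import Data.Nat using (ℕ; _+_; _*_; _≥_)
open import Data.Nat.Divisibility using (_∣_)
open import Data.Nat.GCD using (gcd)
open import Data.Integer using (ℤ; +_; _-_; _≤_; ∣_∣) renaming (_*_ to _*ℤ_; _+_ to _+ℤ_)
open import Data.Rational using (ℚ; floor; ceiling) renaming (_-_ to _-ℚ_; _*_ to _*ℚ_)
open import Data.Bool using (Bool)
open import Relation.Binary.PropositionalEquality using (_≡_)

import Data.Nat as ℕ
open import Data.Nat using (>-nonZero)
import Data.Nat.Properties as ℕP
open import Data.Nat.Divisibility using (divides)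
open import Data.Product using (_,_; proj₁; proj₂)
open import Relation.Binary.PropositionalEquality using (refl; sym; subst)

count-bound-from-roundings : ∀ {t r₁ r₂ r k} → 1 ℕ.≤ t → 1 ℕ.≤ r₁ → 1 ℕ.≤ r₂ → 1 ℕ.≤ r * (k * t) →
  t ≡ gcd (r₁ * t) (r₂ * t) → r₂ ℕ.≤ r₁ → ∀ {S} → LFree (r₁ * t) (r₂ * t) r S → (k * t) ∈ₛ S →
  (c F₁ W F₂ : ℤ) →
  + (r * (k * t)) ≤ c *ℤ + (r₂ * t) →
  F₁ *ℤ + (r₂ * (r₁ * t + r₂ * t)) ≤ + (r * (k * t)) →
  W *ℤ + (r₁ * (r₁ * t + r₂ * t) * r₂) ≤ + (r * (k * t)) *ℤ + r₂ - + (r₁ * (r₁ * t + r₂ * t)) →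
  F₂ *ℤ + (r₁ * r₂) ≤ W →
  + countIn S ∣ c - + 1 ∣ ≤ c - + 1 - F₁ - (+ (r₁ * r₂) - + r₁ - + r₂ +ℤ + 1) *ℤ F₂
count-bound-from-roundings {t} {r₁} {r₂} {r} {k} t≥1 r₁≥1 r₂≥1 A≥1 t≡gcd r₂≤r₁ free M∈S c F₁ W F₂ A≤c F₁≤ W≤ F₂≤
  with upper-factor-suc c A≥1 (ℕP.*-mono-≤ r₂≥1 t≥1) A≤c
     | lower-factor-ℕ F₁ F₁≤
     | nested-lower-factor-ℕ F₂ W A≥1 (ℕP.*-mono-≤ r₁≥1 p+q≥1) r₂≥1 F₂≤ W≤
  where
  p+q≥1 : 1 ℕ.≤ r₁ * t + r₂ * t
  p+q≥1 = ℕP.≤-trans (ℕP.*-mono-≤ r₁≥1 t≥1) (ℕP.m≤m+n (r₁ * t) (r₂ * t))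
... | K , refl , A≤ | f₁ , F₁≤f₁ , f₁≤ | f₂ , F₂≤f₂ , f₂< = subtract-bounds
  (L-free-count-bound {t} {r₁} {r₂} {r} {k} {{>-nonZero t≥1}} {{>-nonZero r₁≥1}} {{>-nonZero r₂≥1}}
    (coprime-cofactors {{>-nonZero t≥1}} t≡gcd) r₂≤r₁ free M∈S {K} {f₁} {f₂} A≤ f₁≤ f₂<)
  F₁≤f₁
  (subst (λ z → z *ℤ F₂ ≤ + (f₂ * ((r₁ ℕ.∸ 1) * (r₂ ℕ.∸ 1)))) (sym (ab-a-b+1≡[a∸1][b∸1] r₁ r₂ r₁≥1 r₂≥1))
    (scale-nonNeg _ F₂≤f₂))

lemma2p6 : (p q r : ℕ) → p ≥ 1 → q ≥ 1 → r ≥ 1 → p ≥ q → q ≥ r →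
           gcd (gcd p q) r ≡ 1 →
           (t r₁ r₂ : ℕ) → t ≡ gcd p q → r₁ * t ≡ p → r₂ * t ≡ q →
           (n : ℕ) (S : ℕ → Bool) → SubsetOf[ n ] S → LFree p q r S →
           (M : ℕ) → M ∈ₛ S → t ∣ M →
           + countIn S (∣ ceiling ((+ (r * M)) ÷ q) - + 1 ∣)
             ≤ ceiling ((+ (r * M)) ÷ q) - + 1
               - floor ((+ (r * M)) ÷ (r₂ * (p + q)))
               - (+ (r₁ * r₂) - + r₁ - + r₂ +ℤ + 1)
                 *ℤ floor (((floor (((+ (r * M)) ÷ (r₁ * (p + q))) -ℚ ((+ 1) ÷ r₂))) ÷ 1)
                           *ℚ ((+ 1) ÷ (r₁ * r₂)))
lemma2p6 .(r₁ * t) .(r₂ * t) r p≥1 q≥1 r≥1 p≥q _ _ t r₁ r₂ t≡gcd refl refl n S S⊆[n] free .(k * t) M∈S (divides k refl) =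
  count-bound-from-roundings {t} {r₁} {r₂} {r} {k} t≥1 r₁≥1 r₂≥1 A≥1 t≡gcd r₂≤r₁ free M∈S
    (ceiling ((+ A) ÷ q)) (floor ((+ A) ÷ (r₂ * (p + q)))) W (floor ((W ÷ 1) *ℚ ((+ 1) ÷ (r₁ * r₂))))
    (ceiling-÷ (+ A) q q≥1)
    (floor-÷ (+ A) (r₂ * (p + q)) (ℕP.*-mono-≤ r₂≥1 p+q≥1))
    (floor-÷-minus-÷ (+ A) (r₁ * (p + q)) r₂ (ℕP.*-mono-≤ r₁≥1 p+q≥1) r₂≥1)
    (floor-÷1-*-÷ W (r₁ * r₂) (ℕP.*-mono-≤ r₁≥1 r₂≥1))
  where
  p q A : ℕ
  p = r₁ * t
  q = r₂ * t
  A = r * (k * t)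
  r₁≥1 : 1 ℕ.≤ r₁
  r₁≥1 = proj₁ (factors-positive r₁ t p≥1)
  t≥1 : 1 ℕ.≤ t
  t≥1 = proj₂ (factors-positive r₁ t p≥1)
  r₂≥1 : 1 ℕ.≤ r₂
  r₂≥1 = proj₁ (factors-positive r₂ t q≥1)
  r₂≤r₁ : r₂ ℕ.≤ r₁
  r₂≤r₁ = ℕP.*-cancelʳ-≤ r₂ r₁ t {{>-nonZero t≥1}} p≥q
  p+q≥1 : 1 ℕ.≤ p + q
  p+q≥1 = ℕP.≤-trans p≥1 (ℕP.m≤m+n p q)
  A≥1 : 1 ℕ.≤ A
  A≥1 = ℕP.*-mono-≤ r≥1 (proj₁ (S⊆[n] (k * t) M∈S))
  W : ℤ
  W = floor (((+ A) ÷ (r₁ * (p + q))) -ℚ ((+ 1) ÷ r₂))
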